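{- Let $i\in[n-1]$ and let $\pi\in S_n$ satisfy $\mathrm{supp}(\pi)\subseteq[i]$. Then (1) $$\sum_{r\in S_n:\ \mathrm{Des}_S(r^{ -1})\subseteq\{i\},\ \pi r(1)=i+1}q^{\mathrm{rmaj}_{S_n}(\pi r)-\mathrm{rmaj}_{S_i}(\pi)}=q^i{n-1\brack i}_q,$$ (2) $$\sum_{r\in S_n:\ \mathrm{Des}_S(r^{ -1})\subseteq\{i\},\ \pi r(1)=\pi(1)}q^{\mathrm{rmaj}_{S_n}(\pi r)-\mathrm{rmaj}_{S_i}(\pi)}={n-1\brack i-1}_q.$$
   Context: $\mathrm{supp}(\pi)=\{k:\pi(k)\ne k\}$; a permutation with support in $[i]$ is also regarded as an element of $S_i$. Permutations are in one-line notation and multiplied as functions, $(\sigma\tau)(k)=\sigma(\tau(k))$. $\mathrm{Des}_S(\pi)=\{j:\pi(j)>\pi(j+1)\}$; $\mathrm{rmaj}_{S_m}(\pi)=\sum_{j\in\mathrm{Des}_S(\pi)}(m-j)$ for $\pi\in S_m$. ${n\brack i}_q=\frac{[n]!_q}{[i]!_q[n-i]!_q}$ with $[m]!_q=\prod_{k=1}^m(1+q+\dots+q^{k-1})$. -}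

module Defs where

open import Data.Nat using (ℕ; zero; suc; _+_; _*_; _∸_; _^_; _<_; _<?_; NonZero)
open import Data.Nat.Properties using (m*n≢0)
open import Data.Nat.ListAction using (sum)
open import Data.Nat.DivMod using (_/_)
open import Data.Fin using (Fin; toℕ; fromℕ<) renaming (_≟_ to _≟ᶠ_)
open import Data.Fin.Properties using (any?; all?)
open import Data.Vec using (Vec; []; _∷_; lookup)
open import Data.List using (List; []; _∷_; map; concatMap; filter; upTo; allFin)
open import Data.Product using (proj₁)
open import Relation.Nullary using (yes; no)
open import Relation.Nullary.Decidable using (_→-dec_)
open import Relation.Binary.PropositionalEquality using (_≡_)
open import Function.Definitions using (Injective)

allVecs : (n k : ℕ) → List (Vec (Fin n) k)
allVecs n zero    = [] ∷ []
allVecs n (suc k) = concatMap (λ x → map (x ∷_) (allVecs n k)) (allFin n)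

-- S_n: all bijections Fin n → Fin n (positions/values 0-indexed here;
-- Fin value k stands for k+1 ∈ [n]).
perms : (n : ℕ) → List (Fin n → Fin n)
perms n = filter (λ f → all? λ x → all? λ y → (f x ≟ᶠ f y) →-dec (x ≟ᶠ y))
                 (map lookup (allVecs n n))

inv : {n : ℕ} → (Fin n → Fin n) → Fin n → Fin n
inv f y with any? (λ x → f x ≟ᶠ y)
... | yes p = proj₁ p
... | no _  = y

-- One-line notation, 1-indexed: val f j = f(j) ∈ [n] for j ∈ [n], 0 otherwise.
val : {n : ℕ} → (Fin n → Fin n) → ℕ → ℕ
val f zero = 0
val {n} f (suc k) with k <? n
... | yes p = suc (toℕ (f (fromℕ< p)))
... | no _  = 0

Des : ℕ → (ℕ → ℕ) → List ℕ
Des m w = filter (λ j → w (suc j) <? w j) (map suc (upTo (m ∸ 1)))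

rmaj : ℕ → (ℕ → ℕ) → ℕ
rmaj m w = sum (map (λ j → m ∸ j) (Des m w))

qint : ℕ → ℕ → ℕ
qint q k = sum (map (q ^_) (upTo k))

qfact : ℕ → ℕ → ℕ
qfact q zero    = 1
qfact q (suc m) = qint q (suc m) * qfact q m

qfact-nz : ∀ q m → NonZero (qfact q m)
qfact-nz q zero    = _
qfact-nz q (suc m) = m*n≢0 (qint q (suc m)) (qfact q m) {{_}} {{qfact-nz q m}}

qbinom : ℕ → ℕ → ℕ → ℕ
qbinom q n i = (qfact q n / (qfact q i * qfact q (n ∸ i)))
  {{m*n≢0 (qfact q i) (qfact q (n ∸ i)) {{qfact-nz q i}} {{qfact-nz q (n ∸ i)}}}}

-- A permutation r has Des(r⁻¹) ⊆ {i} exactly when its one-line word is a shuffle of the runs 1, …, i and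
-- i+1, …, n, and πr relabels the first run by π, which fixes every letter above i. So πr descends either
-- inside the relabelled first run, exactly where π does, or where a high letter is followed by a low one.
-- Splitting the shuffles by their first letter, the sums of q^rmaj satisfy the two q-Pascal recurrences,
-- whence the words starting with i+1, resp. π(1), contribute q^rmaj(π) q^i [n-1, i]_q, resp.
-- q^rmaj(π) [n-1, i-1]_q.
module Submission where

open import Defs
open import Data.Nat
  using (ℕ; zero; suc; _+_; _*_; _∸_; _^_; _≤_; _<_; _≟_; _<?_; z≤n; s≤s; s≤s⁻¹; NonZero)
open import Data.Nat.Properties
open import Data.Nat.ListAction using (sum)
open import Data.Nat.ListAction.Properties using (sum-++)
open import Data.Nat.DivMod using (_/_; m*n/n≡m)
open import Data.Nat.Tactic.RingSolver using (solve-∀)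
open import Data.List
  using (List; []; _∷_; _++_; map; filter; concatMap; applyUpTo; upTo; length; tabulate; allFin)
open import Data.List.Properties
  using (map-++; map-∘; map-cong; map-cong-local; map-upTo; length-applyUpTo; length-map; map-tabulate)
open import Data.Fin
  using (Fin; toℕ; fromℕ<; punchOut) renaming (zero to fzero; suc to fsuc; _≟_ to _≟ᶠ_)
open import Data.Fin.Properties
  using ( any?; toℕ-fromℕ<; fromℕ<-cong; fromℕ<-toℕ; toℕ-injective; toℕ<n
        ; punchOut-injective; injective⇒≤)
  renaming (suc-injective to fsuc-injective; all? to allᶠ?)
open import Function.Definitions using (Injective)
open import Data.Vec using (Vec; toList; lookup) renaming ([] to []ᵥ; _∷_ to _∷ᵥ_)
import Data.Vec as Vec
open import Data.Sum using (_⊎_; inj₁; inj₂)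
open import Data.Product using (_×_; _,_; proj₁; proj₂; Σ)
open import Data.List.Membership.Propositional using (_∈_; _∉_)
open import Data.List.Relation.Unary.Any using (here; there)
open import Data.List.Relation.Unary.All using (All; []; _∷_; all?)
import Data.List.Relation.Unary.All as All
open import Data.List.Relation.Unary.All.Properties
  using (¬Any⇒All¬; All¬⇒¬Any; map⁺; map⁻; ++⁺; applyUpTo⁺₁; applyUpTo⁻)
open import Data.List.Relation.Unary.AllPairs using ([]; _∷_)
open import Data.List.Relation.Unary.Unique.Propositional using (Unique)
open import Relation.Nullary using (Dec; yes; no; ¬_)
open import Relation.Nullary.Decidable using (_×-dec_; _→-dec_)
open import Relation.Binary.PropositionalEquality
open import Data.Empty using (⊥-elim)
open import Function using (_∘_; id)

when : ∀ {p} {P : Set p} → Dec P → ℕ → ℕ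
when (yes _) x = x
when (no _)  _ = 0

whenList : ∀ {p} {P : Set p} {A : Set} → Dec P → List A → List A
whenList (yes _) xs = xs
whenList (no _)  _  = []

All-whenList : ∀ {p q} {P : Set p} {A : Set} {Q : A → Set q} (d : Dec P) {xs : List A} →
               All Q xs → All Q (whenList d xs)
All-whenList (yes _) qs = qs
All-whenList (no _)  _  = []

module _ {p} {P : Set p} where

  when-yes : (d : Dec P) → P → ∀ x → when d x ≡ x
  when-yes (yes _) _ x = refl
  when-yes (no ¬p) p x = ⊥-elim (¬p p)

  when-no : (d : Dec P) → ¬ P → ∀ x → when d x ≡ 0
  when-no (yes p) ¬p x = ⊥-elim (¬p p)
  when-no (no _)  _  x = refl

  when-zero : (d : Dec P) → when d 0 ≡ 0
  when-zero (yes _) = refl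
  when-zero (no _)  = refl

module _ {A : Set} where

  sum-map-++ : (f : A → ℕ) (xs ys : List A) →
               sum (map f (xs ++ ys)) ≡ sum (map f xs) + sum (map f ys)
  sum-map-++ f xs ys = trans (cong sum (map-++ f xs ys)) (sum-++ (map f xs) (map f ys))

  sum-map-cong : {f g : A → ℕ} → (∀ x → f x ≡ g x) → (xs : List A) →
                 sum (map f xs) ≡ sum (map g xs)
  sum-map-cong f≗g xs = cong sum (map-cong f≗g xs)

  sum-map-filter : ∀ {q} {Q : A → Set q} (Q? : ∀ x → Dec (Q x)) (f : A → ℕ) (xs : List A) →
                   sum (map f (filter Q? xs)) ≡ sum (map (λ x → when (Q? x) (f x)) xs)
  sum-map-filter Q? f []       = refl
  sum-map-filter Q? f (x ∷ xs) with Q? x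
  ... | yes _ = cong (f x +_) (sum-map-filter Q? f xs)
  ... | no _  = sum-map-filter Q? f xs

  sum-map-when : ∀ {p} {P : Set p} (d : Dec P) (f : A → ℕ) (xs : List A) →
                 sum (map (λ x → when d (f x)) xs) ≡ when d (sum (map f xs))
  sum-map-when (yes _) f xs       = refl
  sum-map-when (no _)  f []       = refl
  sum-map-when (no ¬p) f (x ∷ xs) = sum-map-when (no ¬p) f xs

  sum-map-when-* : ∀ {p} {P : Set p} (d : Dec P) (f g : A → ℕ) (xs : List A) →
                   sum (map (λ x → when d (f x) * g x) xs) ≡ when d (sum (map (λ x → f x * g x) xs))
  sum-map-when-* (yes _) f g xs       = refl
  sum-map-when-* (no _)  f g []       = refl
  sum-map-when-* (no ¬p) f g (x ∷ xs) = sum-map-when-* (no ¬p) f g xs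

  sum-map-whenList : ∀ {p} {P : Set p} (d : Dec P) (f : A → ℕ) (xs : List A) →
                     sum (map f (whenList d xs)) ≡ when d (sum (map f xs))
  sum-map-whenList (yes _) f xs = refl
  sum-map-whenList (no _)  f xs = refl

  sum-map-+ : (f g : A → ℕ) (xs : List A) →
              sum (map (λ x → f x + g x) xs) ≡ sum (map f xs) + sum (map g xs)
  sum-map-+ f g []       = refl
  sum-map-+ f g (x ∷ xs) rewrite sum-map-+ f g xs = +-+-interchange (f x) (g x) _ _
    where
    +-+-interchange : ∀ a b c d → a + b + (c + d) ≡ a + c + (b + d)
    +-+-interchange = solve-∀

  sum-map-*ˡ : (c : ℕ) (f : A → ℕ) (xs : List A) →
               sum (map (λ x → c * f x) xs) ≡ c * sum (map f xs)
  sum-map-*ˡ c f []       = sym (*-zeroʳ c)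
  sum-map-*ˡ c f (x ∷ xs) rewrite sum-map-*ˡ c f xs = sym (*-distribˡ-+ c (f x) _)

module _ {A B : Set} where

  sum-map-∘ : (f : B → ℕ) (g : A → B) (xs : List A) →
              sum (map f (map g xs)) ≡ sum (map (f ∘ g) xs)
  sum-map-∘ f g xs = cong sum (sym (map-∘ xs))

  sum-map-concatMap : (f : B → ℕ) (g : A → List B) (xs : List A) →
                      sum (map f (concatMap g xs)) ≡ sum (map (λ x → sum (map f (g x))) xs)
  sum-map-concatMap f g []       = refl
  sum-map-concatMap f g (x ∷ xs) =
    trans (sum-map-++ f (g x) _) (cong (sum (map f (g x)) +_) (sum-map-concatMap f g xs))

sum-tabulate-zero : ∀ m (h : ℕ → ℕ) → (∀ y → h y ≡ 0) →
                    sum (tabulate {n = m} (h ∘ toℕ)) ≡ 0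
sum-tabulate-zero zero    h h≗0 = refl
sum-tabulate-zero (suc m) h h≗0 rewrite h≗0 0 = sum-tabulate-zero m (h ∘ suc) (h≗0 ∘ suc)

sum-tabulate-single : ∀ m s (h : ℕ → ℕ) → s < m → (∀ y → y ≢ s → h y ≡ 0) →
                      sum (tabulate {n = m} (h ∘ toℕ)) ≡ h s
sum-tabulate-single (suc m) zero    h _ h≗0 =
  trans (cong (h 0 +_) (sum-tabulate-zero m (h ∘ suc) (λ y → h≗0 (suc y) (λ ())))) (+-identityʳ _)
sum-tabulate-single (suc m) (suc s) h (s≤s s<m) h≗0 rewrite h≗0 0 (λ ()) =
  sum-tabulate-single m s (h ∘ suc) s<m (λ y y≢s → h≗0 (suc y) (y≢s ∘ suc-injective))

sum-allFin-when-≟ : ∀ {p} {P : Set p} m s (d : Dec P) (g : ℕ → ℕ) → (P → s < m) →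
  sum (map (λ x → when (toℕ x ≟ s) (when d (g (toℕ x)))) (allFin m)) ≡ when d (g s)
sum-allFin-when-≟ m s (no _)  g _       =
  trans (cong sum (map-tabulate {n = m} id (λ x → when (toℕ x ≟ s) 0)))
        (sum-tabulate-zero m (λ y → when (y ≟ s) 0) (λ y → when-zero (y ≟ s)))
sum-allFin-when-≟ m s (yes p) g P⇒s<m =
  trans (cong sum (map-tabulate {n = m} id (λ x → when (toℕ x ≟ s) (g (toℕ x)))))
        (trans (sum-tabulate-single m s (λ y → when (y ≟ s) (g y)) (P⇒s<m p)
                                    (λ y y≢s → when-no (y ≟ s) y≢s _))
               (when-yes (s ≟ s) refl _))

module QBinomial (q : ℕ) where

  sum-pow-applyUpTo-suc : ∀ m (f : ℕ → ℕ) →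
    sum (map (q ^_) (applyUpTo (suc ∘ f) m)) ≡ q * sum (map (q ^_) (applyUpTo f m))
  sum-pow-applyUpTo-suc zero    f = sym (*-zeroʳ q)
  sum-pow-applyUpTo-suc (suc m) f rewrite sum-pow-applyUpTo-suc m (f ∘ suc) =
    sym (*-distribˡ-+ q (q ^ f 0) _)

  qint-suc : ∀ m → qint q (suc m) ≡ 1 + q * qint q m
  qint-suc m = cong (1 +_) (sum-pow-applyUpTo-suc m (λ k → k))

  qint-+ : ∀ x y → qint q (x + y) ≡ qint q x + q ^ x * qint q y
  qint-+ zero    y = sym (cong (_+_ 0) (*-identityˡ (qint q y)))
  qint-+ (suc x) y = begin
    qint q (suc (x + y))                         ≡⟨ qint-suc (x + y) ⟩
    1 + q * qint q (x + y)                       ≡⟨ cong (λ z → 1 + q * z) (qint-+ x y) ⟩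
    1 + q * (qint q x + q ^ x * qint q y)        ≡⟨ distrib q (qint q x) (q ^ x) (qint q y) ⟩
    (1 + q * qint q x) + q * q ^ x * qint q y    ≡⟨ cong (_+ q ^ suc x * qint q y) (sym (qint-suc x)) ⟩
    qint q (suc x) + q ^ suc x * qint q y        ∎
    where
    open ≡-Reasoning
    distrib : ∀ q a p b → 1 + q * (a + p * b) ≡ (1 + q * a) + q * p * b
    distrib = solve-∀

  gaussian : ℕ → ℕ → ℕ
  gaussian m       zero    = 1
  gaussian zero    (suc j) = 0
  gaussian (suc m) (suc j) = gaussian m j + q ^ suc j * gaussian m (suc j)

  gaussian-> : ∀ m j → m < j → gaussian m j ≡ 0
  gaussian-> zero    (suc j) _ = refl
  gaussian-> (suc m) (suc j) (s≤s m<j)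
    rewrite gaussian-> m j m<j | gaussian-> m (suc j) (m<n⇒m<1+n m<j) | *-zeroʳ (q ^ suc j) = refl

  gaussian-diag : ∀ m → gaussian m m ≡ 1
  gaussian-diag zero = refl
  gaussian-diag (suc m)
    rewrite gaussian-diag m | gaussian-> m (suc m) (n<1+n m) | *-zeroʳ (q ^ suc m) = refl

  qfact-*-nonZero : ∀ a b → NonZero (qfact q a * qfact q b)
  qfact-*-nonZero a b = m*n≢0 (qfact q a) (qfact q b) {{qfact-nz q a}} {{qfact-nz q b}}

  mutual
    gaussian-*-qfacts : ∀ m j → j ≤ m → gaussian m j * (qfact q j * qfact q (m ∸ j)) ≡ qfact q m
    gaussian-*-qfacts m       zero    _         = trans (+-identityʳ _) (+-identityʳ _)
    gaussian-*-qfacts (suc m) (suc j) (s≤s j≤m) = begin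
      (gaussian m j + q ^ suc j * gaussian m (suc j)) * (qint q (suc j) * qfact q j * qfact q (m ∸ j))
        ≡⟨ expand (gaussian m j) (gaussian m (suc j)) (q ^ suc j) (qint q (suc j)) (qfact q j) _ ⟩
      qint q (suc j) * (gaussian m j * (qfact q j * qfact q (m ∸ j)))
        + q ^ suc j * (gaussian m (suc j) * (qfact q (suc j) * qfact q (m ∸ j)))
        ≡⟨ cong₂ (λ u v → qint q (suc j) * u + q ^ suc j * v)
                 (gaussian-*-qfacts m j j≤m) (gaussian-suc-*-qfacts m j j≤m) ⟩
      qint q (suc j) * qfact q m + q ^ suc j * (qint q (m ∸ j) * qfact q m)
        ≡⟨ factor (qint q (suc j)) (q ^ suc j) (qint q (m ∸ j)) (qfact q m) ⟩
      (qint q (suc j) + q ^ suc j * qint q (m ∸ j)) * qfact q m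
        ≡⟨ cong (_* qfact q m) (sym (qint-+ (suc j) (m ∸ j))) ⟩
      qint q (suc j + (m ∸ j)) * qfact q m
        ≡⟨ cong (λ k → qint q (suc k) * qfact q m) (m+[n∸m]≡n j≤m) ⟩
      qfact q (suc m) ∎
      where
      open ≡-Reasoning
      expand : ∀ x y p a f g → (x + p * y) * (a * f * g) ≡ a * (x * (f * g)) + p * (y * (a * f * g))
      expand = solve-∀
      factor : ∀ a p c h → a * h + p * (c * h) ≡ (a + p * c) * h
      factor = solve-∀

    gaussian-suc-*-qfacts : ∀ m j → j ≤ m →
      gaussian m (suc j) * (qfact q (suc j) * qfact q (m ∸ j)) ≡ qint q (m ∸ j) * qfact q m
    gaussian-suc-*-qfacts m j j≤m with m≤n⇒m<n∨m≡n j≤m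
    ... | inj₂ refl rewrite gaussian-> m (suc m) (n<1+n m) | n∸n≡0 m = refl
    ... | inj₁ j<m rewrite +-∸-assoc 1 j<m = begin
      gaussian m (suc j) * (qfact q (suc j) * (qint q c * qfact q (m ∸ suc j)))
        ≡⟨ swap (gaussian m (suc j)) (qfact q (suc j)) (qint q c) (qfact q (m ∸ suc j)) ⟩
      qint q c * (gaussian m (suc j) * (qfact q (suc j) * qfact q (m ∸ suc j)))
        ≡⟨ cong (qint q c *_) (gaussian-*-qfacts m (suc j) j<m) ⟩
      qint q c * qfact q m ∎
      where
      open ≡-Reasoning
      c = suc (m ∸ suc j)
      swap : ∀ g f a h → g * (f * (a * h)) ≡ a * (g * (f * h))
      swap = solve-∀

  qbinom≡gaussian : ∀ m j → j ≤ m → qbinom q m j ≡ gaussian m j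
  qbinom≡gaussian m j j≤m =
    trans (cong (λ z → (z / K) {{qfact-*-nonZero j (m ∸ j)}}) (sym (gaussian-*-qfacts m j j≤m)))
          (m*n/n≡m (gaussian m j) K {{qfact-*-nonZero j (m ∸ j)}})
    where K = qfact q j * qfact q (m ∸ j)

  -- Both sides have the same product with [j+1]! [m-j]!.
  gaussian-pascalʳ : ∀ m j → j ≤ m →
                     gaussian (suc m) (suc j) ≡ q ^ (m ∸ j) * gaussian m j + gaussian m (suc j)
  gaussian-pascalʳ m j j≤m =
    *-cancelʳ-≡ _ _ K {{qfact-*-nonZero (suc j) (m ∸ j)}}
      (trans (gaussian-*-qfacts (suc m) (suc j) (s≤s j≤m)) (sym rhs-*-K))
    where
    open ≡-Reasoning
    K = qfact q (suc j) * qfact q (m ∸ j)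
    expand : ∀ p x y a f g → (p * x + y) * (a * f * g) ≡ p * a * (x * (f * g)) + y * (a * f * g)
    expand = solve-∀
    factor : ∀ p a h c → p * a * h + c * h ≡ (c + p * a) * h
    factor = solve-∀
    rhs-*-K : (q ^ (m ∸ j) * gaussian m j + gaussian m (suc j)) * K ≡ qfact q (suc m)
    rhs-*-K = begin
      (q ^ (m ∸ j) * gaussian m j + gaussian m (suc j)) * (qint q (suc j) * qfact q j * qfact q (m ∸ j))
        ≡⟨ expand (q ^ (m ∸ j)) (gaussian m j) (gaussian m (suc j)) (qint q (suc j)) (qfact q j) _ ⟩
      q ^ (m ∸ j) * qint q (suc j) * (gaussian m j * (qfact q j * qfact q (m ∸ j)))
        + gaussian m (suc j) * K
        ≡⟨ cong₂ (λ u v → q ^ (m ∸ j) * qint q (suc j) * u + v)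
                 (gaussian-*-qfacts m j j≤m) (gaussian-suc-*-qfacts m j j≤m) ⟩
      q ^ (m ∸ j) * qint q (suc j) * qfact q m + qint q (m ∸ j) * qfact q m
        ≡⟨ factor (q ^ (m ∸ j)) (qint q (suc j)) (qfact q m) (qint q (m ∸ j)) ⟩
      (qint q (m ∸ j) + q ^ (m ∸ j) * qint q (suc j)) * qfact q m
        ≡⟨ cong (_* qfact q m) (sym (qint-+ (m ∸ j) (suc j))) ⟩
      qint q (m ∸ j + suc j) * qfact q m
        ≡⟨ cong (λ z → qint q z * qfact q m)
                (trans (+-comm (m ∸ j) (suc j)) (cong suc (m+[n∸m]≡n j≤m))) ⟩
      qfact q (suc m) ∎

  gaussian-pascalʳ-+ : ∀ a b → gaussian (suc (a + suc b)) (suc a)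
                               ≡ q ^ suc b * gaussian (a + suc b) a + gaussian (a + suc b) (suc a)
  gaussian-pascalʳ-+ a b = trans (gaussian-pascalʳ (a + suc b) a (m≤m+n a (suc b)))
    (cong (λ e → q ^ e * gaussian (a + suc b) a + gaussian (a + suc b) (suc a)) (m+n∸m≡n a (suc b)))

rmajList : List ℕ → ℕ
rmajList []          = 0
rmajList (x ∷ [])    = 0
rmajList (x ∷ y ∷ w) = when (y <? x) (suc (length w)) + rmajList (y ∷ w)

interval : ℕ → ℕ → List ℕ
interval s zero    = []
interval s (suc a) = s ∷ interval (suc s) a

length-map-interval : ∀ (g : ℕ → ℕ) s a → length (map g (interval s a)) ≡ a
length-map-interval g s zero    = refl
length-map-interval g s (suc a) = cong suc (length-map-interval g (suc s) a)

applyUpTo≡map-interval : ∀ (h g : ℕ → ℕ) s a → (∀ k → k < a → h k ≡ g (s + k)) →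
                         applyUpTo h a ≡ map g (interval s a)
applyUpTo≡map-interval h g s zero    h≗g = refl
applyUpTo≡map-interval h g s (suc a) h≗g =
  cong₂ _∷_ (trans (h≗g 0 (s≤s z≤n)) (cong g (+-identityʳ s)))
            (applyUpTo≡map-interval (h ∘ suc) g (suc s) a
              (λ k k<a → trans (h≗g (suc k) (s≤s k<a)) (cong g (+-suc s k))))

sum-descents≡rmajList : ∀ a (u : ℕ → ℕ) →
  sum (applyUpTo (λ j → when (u (suc j) <? u j) (a ∸ j)) a) ≡ rmajList (applyUpTo u (suc a))
sum-descents≡rmajList zero    u = refl
sum-descents≡rmajList (suc a) u =
  cong₂ _+_ (cong (λ l → when (u 1 <? u 0) (suc l)) (sym (length-applyUpTo (u ∘ suc ∘ suc) a)))
            (sum-descents≡rmajList a (u ∘ suc))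

rmaj≡rmajList : ∀ m (w : ℕ → ℕ) → rmaj m w ≡ rmajList (applyUpTo (w ∘ suc) m)
rmaj≡rmajList zero    w = refl
rmaj≡rmajList (suc a) w = begin
  sum (map (suc a ∸_) (filter (λ j → w (suc j) <? w j) (map suc (upTo a))))
    ≡⟨ sum-map-filter (λ j → w (suc j) <? w j) (suc a ∸_) (map suc (upTo a)) ⟩
  sum (map (λ j → when (w (suc j) <? w j) (suc a ∸ j)) (map suc (upTo a)))
    ≡⟨ sum-map-∘ (λ j → when (w (suc j) <? w j) (suc a ∸ j)) suc (upTo a) ⟩
  sum (map (λ j → when (w (suc (suc j)) <? w (suc j)) (a ∸ j)) (upTo a))
    ≡⟨ cong sum (map-upTo _ a) ⟩
  sum (applyUpTo (λ j → when (w (suc (suc j)) <? w (suc j)) (a ∸ j)) a)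
    ≡⟨ sum-descents≡rmajList a (w ∘ suc) ⟩
  rmajList (applyUpTo (w ∘ suc) (suc a)) ∎
  where open ≡-Reasoning

module _ {p q} {A : Set} {P : A → Set p} {Q : A → Set q} (P? : ∀ x → Dec (P x)) where

  All-filter⁻ : ∀ xs → All Q (filter P? xs) → All (λ x → P x → Q x) xs
  All-filter⁻ []       _ = []
  All-filter⁻ (x ∷ xs) qs with P? x
  All-filter⁻ (x ∷ xs) (qx ∷ qs) | yes _ = (λ _ → qx) ∷ All-filter⁻ xs qs
  All-filter⁻ (x ∷ xs) qs        | no ¬px = (λ px → ⊥-elim (¬px px)) ∷ All-filter⁻ xs qs

  All-filter⁺ : ∀ xs → All (λ x → P x → Q x) xs → All Q (filter P? xs)
  All-filter⁺ []       _          = []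
  All-filter⁺ (x ∷ xs) (f ∷ fs) with P? x
  ... | yes px = f px ∷ All-filter⁺ xs fs
  ... | no _   = All-filter⁺ xs fs

module _ {q} {Q : ℕ → Set q} (m : ℕ) (u : ℕ → ℕ) where

  All-Des⁻ : All Q (Des m u) → ∀ y → y < m ∸ 1 → u (suc (suc y)) < u (suc y) → Q (suc y)
  All-Des⁻ qs y y<m = applyUpTo⁻ id (m ∸ 1) (map⁻ (All-filter⁻ (λ j → u (suc j) <? u j) _ qs)) y<m

  All-Des⁺ : (∀ y → y < m ∸ 1 → u (suc (suc y)) < u (suc y) → Q (suc y)) → All Q (Des m u)
  All-Des⁺ f = All-filter⁺ (λ j → u (suc j) <? u j) _ (map⁺ (applyUpTo⁺₁ id (m ∸ 1) (f _)))

val-suc : ∀ {n} (f : Fin n → Fin n) k (k<n : k < n) → val f (suc k) ≡ suc (toℕ (f (fromℕ< k<n)))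
val-suc {n} f k k<n with k <? n
... | yes k<n′ = cong (suc ∘ toℕ ∘ f) (fromℕ<-cong k k refl k<n′ k<n)
... | no k≮n   = ⊥-elim (k≮n k<n)

val-suc-toℕ : ∀ {n} (f : Fin n → Fin n) (x : Fin n) → val f (suc (toℕ x)) ≡ suc (toℕ (f x))
val-suc-toℕ f x = trans (val-suc f (toℕ x) (toℕ<n x))
                        (cong (suc ∘ toℕ ∘ f) (fromℕ<-toℕ x (toℕ<n x)))

injective⇒surjective : ∀ {m} (f : Fin m → Fin m) → Injective _≡_ _≡_ f →
                       ∀ y → Σ (Fin m) λ x → f x ≡ y
injective⇒surjective {suc m} f inj y with any? (λ x → f x ≟ᶠ y)
... | yes hit = hit
... | no miss = ⊥-elim (<-irrefl refl (injective⇒≤ {f = g} g-injective))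
  where
  g : Fin (suc m) → Fin m
  g x = punchOut {i = y} {j = f x} (λ y≡fx → miss (x , sym y≡fx))
  g-injective : Injective _≡_ _≡_ g
  g-injective {a} {b} =
    inj ∘ punchOut-injective (λ y≡fa → miss (a , sym y≡fa)) (λ y≡fb → miss (b , sym y≡fb))

inv-spec : ∀ {n} (f : Fin n → Fin n) → Injective _≡_ _≡_ f → ∀ {x y} → f x ≡ y → inv f y ≡ x
inv-spec f inj {x} {y} fx≡y with any? (λ x → f x ≟ᶠ y)
... | yes (x′ , fx′≡y) = inj (trans fx′≡y (sym fx≡y))
... | no miss          = ⊥-elim (miss (x , fx≡y))

data Precedes (a b : ℕ) : List ℕ → Set where
  now   : ∀ {w} → b ∈ w → Precedes a b (a ∷ w)
  later : ∀ {c w} → Precedes a b w → Precedes a b (c ∷ w)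

Precedes⇒∈ : ∀ {a b w} → Precedes a b w → b ∈ w
Precedes⇒∈ (now b∈w)  = there b∈w
Precedes⇒∈ (later ab) = there (Precedes⇒∈ ab)

¬Precedes-head : ∀ {a x w} → Unique (x ∷ w) → ¬ Precedes a x (x ∷ w)
¬Precedes-head (x∉w ∷ _) (now x∈w)  = All¬⇒¬Any x∉w x∈w
¬Precedes-head (x∉w ∷ _) (later ax) = All¬⇒¬Any x∉w (Precedes⇒∈ ax)

Precedes-tail : ∀ {a b c w} → Precedes a b (c ∷ w) → a ≢ c → Precedes a b w
Precedes-tail (now _)    a≢a = ⊥-elim (a≢a refl)
Precedes-tail (later ab) _   = ab

head-is-least : ∀ {lo x w} → Unique (x ∷ w) → lo ≤ x →
  (∀ y → lo ≤ y → suc y ≡ x → Precedes y (suc y) (x ∷ w)) → x ≡ lo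
head-is-least {lo} {zero}  _ z≤n  _   = refl
head-is-least {lo} {suc y} u lo≤x asc with lo ≟ suc y
... | yes lo≡x = sym lo≡x
... | no lo≢x  = ⊥-elim (¬Precedes-head u (asc y (s≤s⁻¹ (≤∧≢⇒< lo≤x lo≢x)) refl))

word : ∀ {n k} → Vec (Fin n) k → List ℕ
word = toList ∘ Vec.map toℕ

suc<⇒<∸1 : ∀ {y} m → suc y < m → y < m ∸ 1
suc<⇒<∸1 (suc m) (s≤s sy<m) = sy<m

<∸1⇒suc< : ∀ {y} m → y < m ∸ 1 → suc y < m
<∸1⇒suc< (suc m) y<m = s≤s y<m

preimage-toℕ : ∀ {n} (r : Fin n → Fin n) → Injective _≡_ _≡_ r →
               ∀ y → y < n → Σ (Fin n) λ p → toℕ (r p) ≡ y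
preimage-toℕ r inj y y<n with injective⇒surjective r inj (fromℕ< y<n)
... | p , rp≡y = p , trans (cong toℕ rp≡y) (toℕ-fromℕ< y<n)

val-inv : ∀ {n} (r : Fin n → Fin n) → Injective _≡_ _≡_ r →
          ∀ {p y} → toℕ (r p) ≡ y → val (inv r) (suc y) ≡ suc (toℕ p)
val-inv r inj {p} refl = trans (val-suc-toℕ (inv r) (r p)) (cong (suc ∘ toℕ) (inv-spec r inj refl))

module _ {n : ℕ} where

  toℕ-lookup∈word : ∀ {k} (v : Vec (Fin n) k) (p : Fin k) → toℕ (lookup v p) ∈ word v
  toℕ-lookup∈word (x ∷ᵥ v) fzero    = here refl
  toℕ-lookup∈word (x ∷ᵥ v) (fsuc p) = there (toℕ-lookup∈word v p)

  ∈word⇒lookup : ∀ {k} (v : Vec (Fin n) k) {y} → y ∈ word v →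
                 Σ (Fin k) λ p → toℕ (lookup v p) ≡ y
  ∈word⇒lookup (x ∷ᵥ v) (here y≡x)  = fzero , sym y≡x
  ∈word⇒lookup (x ∷ᵥ v) (there y∈v) with ∈word⇒lookup v y∈v
  ... | p , vp≡y = fsuc p , vp≡y

  Injective⇒Unique-word : ∀ {k} (v : Vec (Fin n) k) → Injective _≡_ _≡_ (lookup v) → Unique (word v)
  Injective⇒Unique-word []ᵥ       _   = []
  Injective⇒Unique-word (x ∷ᵥ v) inj =
    ¬Any⇒All¬ (word v) x∉v ∷ Injective⇒Unique-word v (fsuc-injective ∘ inj)
    where
    x∉v : toℕ x ∉ word v
    x∉v x∈v with p , vp≡x ← ∈word⇒lookup v x∈v
      with () ← inj {fsuc p} {fzero} (toℕ-injective vp≡x)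

  Unique-word⇒Injective : ∀ {k} (v : Vec (Fin n) k) → Unique (word v) → Injective _≡_ _≡_ (lookup v)
  Unique-word⇒Injective (x ∷ᵥ v) _         {fzero}  {fzero}  _     = refl
  Unique-word⇒Injective (x ∷ᵥ v) (x∉v ∷ _) {fzero}  {fsuc b} x≡vb =
    ⊥-elim (All¬⇒¬Any x∉v (subst (λ z → toℕ z ∈ word v) (sym x≡vb) (toℕ-lookup∈word v b)))
  Unique-word⇒Injective (x ∷ᵥ v) (x∉v ∷ _) {fsuc a} {fzero}  va≡x =
    ⊥-elim (All¬⇒¬Any x∉v (subst (λ z → toℕ z ∈ word v) va≡x (toℕ-lookup∈word v a)))
  Unique-word⇒Injective (x ∷ᵥ v) (_ ∷ u)   {fsuc a} {fsuc b} va≡vb =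
    cong fsuc (Unique-word⇒Injective v u va≡vb)

  Precedes-word⇒positions : ∀ {k} (v : Vec (Fin n) k) {a b} → Precedes a b (word v) →
    Σ (Fin k) λ p → Σ (Fin k) λ p′ →
      toℕ p < toℕ p′ × toℕ (lookup v p) ≡ a × toℕ (lookup v p′) ≡ b
  Precedes-word⇒positions (x ∷ᵥ v) (now b∈v) with p′ , vp′≡b ← ∈word⇒lookup v b∈v =
    fzero , fsuc p′ , s≤s z≤n , refl , vp′≡b
  Precedes-word⇒positions (x ∷ᵥ v) (later ab)
    with p , p′ , p<p′ , vp≡a , vp′≡b ← Precedes-word⇒positions v ab =
    fsuc p , fsuc p′ , s≤s p<p′ , vp≡a , vp′≡b

  positions⇒Precedes-word : ∀ {k} (v : Vec (Fin n) k) (p p′ : Fin k) → toℕ p < toℕ p′ →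
    Precedes (toℕ (lookup v p)) (toℕ (lookup v p′)) (word v)
  positions⇒Precedes-word (x ∷ᵥ v) fzero    (fsuc p′) _         = now (toℕ-lookup∈word v p′)
  positions⇒Precedes-word (x ∷ᵥ v) (fsuc p) (fsuc p′) (s≤s p<p′) =
    later (positions⇒Precedes-word v p p′ p<p′)

  applyUpTo≡map-word : ∀ {k} (v : Vec (Fin n) k) (h g : ℕ → ℕ) →
    (∀ p → h (toℕ p) ≡ g (toℕ (lookup v p))) → applyUpTo h k ≡ map g (word v)
  applyUpTo≡map-word []ᵥ       h g h≗g = refl
  applyUpTo≡map-word (x ∷ᵥ v) h g h≗g =
    cong₂ _∷_ (h≗g fzero) (applyUpTo≡map-word v (h ∘ suc) g (h≗g ∘ fsuc))

module Shuffles (n i : ℕ) (i≤n : i ≤ n) where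

  -- For i ≤ t: 1 if the word interleaves the runs s, s+1, …, i-1 and t, t+1, …, n-1, and 0 otherwise.
  shuffleIndicator : ℕ → ℕ → List ℕ → ℕ
  shuffleIndicator s t []      = when (s ≟ i) (when (t ≟ n) 1)
  shuffleIndicator s t (x ∷ w) = when (x ≟ s) (when (s <? i) (shuffleIndicator (suc s) t w))
                               + when (x ≟ t) (when (t <? n) (shuffleIndicator s (suc t) w))

  shuffles : ℕ → ℕ → ℕ → List (List ℕ)
  shuffles zero    s t = whenList (s ≟ i) (whenList (t ≟ n) ([] ∷ []))
  shuffles (suc k) s t = whenList (s <? i) (map (s ∷_) (shuffles k (suc s) t))
                      ++ whenList (t <? n) (map (t ∷_) (shuffles k s (suc t)))

  sum-map-shuffles-suc : ∀ (F : List ℕ → ℕ) k s t → sum (map F (shuffles (suc k) s t))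
    ≡ when (s <? i) (sum (map (F ∘ (s ∷_)) (shuffles k (suc s) t)))
      + when (t <? n) (sum (map (F ∘ (t ∷_)) (shuffles k s (suc t))))
  sum-map-shuffles-suc F k s t =
    trans (sum-map-++ F (whenList (s <? i) (map (s ∷_) (shuffles k (suc s) t))) _)
      (cong₂ _+_ (trans (sum-map-whenList (s <? i) F _)
                        (cong (when (s <? i)) (sum-map-∘ F (s ∷_) (shuffles k (suc s) t))))
                 (trans (sum-map-whenList (t <? n) F _)
                        (cong (when (t <? n)) (sum-map-∘ F (t ∷_) (shuffles k s (suc t))))))

  length-shuffles : ∀ k s t → All (λ w → length w ≡ k) (shuffles k s t)
  length-shuffles zero s t with s ≟ i | t ≟ n
  ... | yes _ | yes _ = refl ∷ []
  ... | yes _ | no _  = []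
  ... | no _  | _     = []
  length-shuffles (suc k) s t =
    ++⁺ (All-whenList (s <? i) (map⁺ (All.map (cong suc) (length-shuffles k (suc s) t))))
        (All-whenList (t <? n) (map⁺ (All.map (cong suc) (length-shuffles k s (suc t)))))

  sum-allVecs-head : ∀ k s t (F : List ℕ → ℕ) (x : Fin n) →
    sum (map (λ v → shuffleIndicator s t (word v) * F (word v)) (map (x ∷ᵥ_) (allVecs n k)))
    ≡ when (toℕ x ≟ s) (when (s <? i)
        (sum (map (λ v → shuffleIndicator (suc s) t (word v) * F (toℕ x ∷ word v)) (allVecs n k))))
      + when (toℕ x ≟ t) (when (t <? n)
        (sum (map (λ v → shuffleIndicator s (suc t) (word v) * F (toℕ x ∷ word v)) (allVecs n k))))
  sum-allVecs-head k s t F x = begin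
    sum (map (λ v → shuffleIndicator s t (word v) * F (word v)) (map (x ∷ᵥ_) V))
      ≡⟨ sum-map-∘ (λ v → shuffleIndicator s t (word v) * F (word v)) (x ∷ᵥ_) V ⟩
    sum (map (λ v → (L₁ v + L₂ v) * F′ v) V)
      ≡⟨ sum-map-cong (λ v → *-distribʳ-+ (F′ v) (L₁ v) (L₂ v)) V ⟩
    sum (map (λ v → L₁ v * F′ v + L₂ v * F′ v) V)
      ≡⟨ sum-map-+ (λ v → L₁ v * F′ v) (λ v → L₂ v * F′ v) V ⟩
    sum (map (λ v → L₁ v * F′ v) V) + sum (map (λ v → L₂ v * F′ v) V)
      ≡⟨ cong₂ _+_ (trans (sum-map-when-* (y ≟ s) (λ v → when (s <? i) (I₁ v)) F′ V)
                          (cong (when (y ≟ s)) (sum-map-when-* (s <? i) I₁ F′ V)))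
                   (trans (sum-map-when-* (y ≟ t) (λ v → when (t <? n) (I₂ v)) F′ V)
                          (cong (when (y ≟ t)) (sum-map-when-* (t <? n) I₂ F′ V))) ⟩
    when (y ≟ s) (when (s <? i) (sum (map (λ v → I₁ v * F′ v) V)))
      + when (y ≟ t) (when (t <? n) (sum (map (λ v → I₂ v * F′ v) V))) ∎
    where
    open ≡-Reasoning
    y = toℕ x
    V = allVecs n k
    I₁ I₂ L₁ L₂ F′ : Vec (Fin n) k → ℕ
    I₁ v = shuffleIndicator (suc s) t (word v)
    I₂ v = shuffleIndicator s (suc t) (word v)
    L₁ v = when (y ≟ s) (when (s <? i) (I₁ v))
    L₂ v = when (y ≟ t) (when (t <? n) (I₂ v))
    F′ v = F (y ∷ word v)

  sum-allVecs-shuffleIndicator : ∀ k s t (F : List ℕ → ℕ) →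
    sum (map (λ v → shuffleIndicator s t (word v) * F (word v)) (allVecs n k))
    ≡ sum (map F (shuffles k s t))
  sum-allVecs-shuffleIndicator zero s t F with s ≟ i | t ≟ n
  ... | yes _ | yes _ = cong (_+ 0) (+-identityʳ _)
  ... | yes _ | no _  = refl
  ... | no _  | _     = refl
  sum-allVecs-shuffleIndicator (suc k) s t F = begin
    sum (map Φ (concatMap (λ x → map (x ∷ᵥ_) (allVecs n k)) (allFin n)))
      ≡⟨ sum-map-concatMap Φ (λ x → map (x ∷ᵥ_) (allVecs n k)) (allFin n) ⟩
    sum (map (λ x → sum (map Φ (map (x ∷ᵥ_) (allVecs n k)))) (allFin n))
      ≡⟨ sum-map-cong (sum-allVecs-head k s t F) (allFin n) ⟩
    sum (map (λ x → H₁ (toℕ x) + H₂ (toℕ x)) (allFin n))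
      ≡⟨ sum-map-+ (H₁ ∘ toℕ) (H₂ ∘ toℕ) (allFin n) ⟩
    sum (map (H₁ ∘ toℕ) (allFin n)) + sum (map (H₂ ∘ toℕ) (allFin n))
      ≡⟨ cong₂ _+_ (sum-allFin-when-≟ n s (s <? i) G₁ (λ s<i → <-≤-trans s<i i≤n))
                   (sum-allFin-when-≟ n t (t <? n) G₂ id) ⟩
    when (s <? i) (G₁ s) + when (t <? n) (G₂ t)
      ≡⟨ cong₂ (λ u v → when (s <? i) u + when (t <? n) v)
               (sum-allVecs-shuffleIndicator k (suc s) t (F ∘ (s ∷_)))
               (sum-allVecs-shuffleIndicator k s (suc t) (F ∘ (t ∷_))) ⟩
    when (s <? i) (sum (map (F ∘ (s ∷_)) (shuffles k (suc s) t)))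
      + when (t <? n) (sum (map (F ∘ (t ∷_)) (shuffles k s (suc t))))
      ≡⟨ sym (sum-map-shuffles-suc F k s t) ⟩
    sum (map F (shuffles (suc k) s t)) ∎
    where
    open ≡-Reasoning
    Φ : Vec (Fin n) (suc k) → ℕ
    Φ v = shuffleIndicator s t (word v) * F (word v)
    G₁ G₂ H₁ H₂ : ℕ → ℕ
    G₁ y = sum (map (λ v → shuffleIndicator (suc s) t (word v) * F (y ∷ word v)) (allVecs n k))
    G₂ y = sum (map (λ v → shuffleIndicator s (suc t) (word v) * F (y ∷ word v)) (allVecs n k))
    H₁ y = when (y ≟ s) (when (s <? i) (G₁ y))
    H₂ y = when (y ≟ t) (when (t <? n) (G₂ y))

  InRuns : ℕ → ℕ → ℕ → Set
  InRuns s t y = (s ≤ y × y < i) ⊎ (t ≤ y × y < n)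

  record IsShuffle (s t : ℕ) (w : List ℕ) : Set where
    field
      unique         : Unique w
      sound          : ∀ {y} → y ∈ w → InRuns s t y
      complete       : ∀ {y} → InRuns s t y → y ∈ w
      ascending-low  : ∀ y → s ≤ y → suc y < i → Precedes y (suc y) w
      ascending-high : ∀ y → t ≤ y → suc y < n → Precedes y (suc y) w

  shuffleIndicator≤1 : ∀ s t w → i ≤ t → shuffleIndicator s t w ≤ 1
  shuffleIndicator≤1 s t [] i≤t with s ≟ i | t ≟ n
  ... | yes _ | yes _ = ≤-refl
  ... | yes _ | no _  = z≤n
  ... | no _  | _     = z≤n
  shuffleIndicator≤1 s t (x ∷ w) i≤t with x ≟ s | s <? i | x ≟ t | t <? n
  ... | yes refl | yes s<i | yes refl | _     = ⊥-elim (<⇒≱ s<i i≤t)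
  ... | yes _    | yes _   | no _     | _     =
    ≤-trans (≤-reflexive (+-identityʳ _)) (shuffleIndicator≤1 (suc s) t w i≤t)
  ... | yes _    | no _    | yes _    | yes _ = shuffleIndicator≤1 s (suc t) w (m≤n⇒m≤1+n i≤t)
  ... | yes _    | no _    | yes _    | no _  = z≤n
  ... | yes _    | no _    | no _     | _     = z≤n
  ... | no _     | _       | yes _    | yes _ = shuffleIndicator≤1 s (suc t) w (m≤n⇒m≤1+n i≤t)
  ... | no _     | _       | yes _    | no _  = z≤n
  ... | no _     | _       | no _     | _     = z≤n

  IsShuffle-∷-low : ∀ {s t w} → s < i → i ≤ t → IsShuffle (suc s) t w → IsShuffle s t (s ∷ w)
  IsShuffle-∷-low {s} {t} {w} s<i i≤t S = record
    { unique = ¬Any⇒All¬ w s∉w ∷ unique ; sound = sound′ ; complete = complete′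
    ; ascending-low  = ascending-low′
    ; ascending-high = λ y t≤y sy<n → later (ascending-high y t≤y sy<n) }
    where
    open IsShuffle S
    s∉w : s ∉ w
    s∉w s∈w with sound s∈w
    ... | inj₁ (s<s , _) = <-irrefl refl s<s
    ... | inj₂ (t≤s , _) = <⇒≱ s<i (≤-trans i≤t t≤s)
    sound′ : ∀ {y} → y ∈ s ∷ w → InRuns s t y
    sound′ (here refl) = inj₁ (≤-refl , s<i)
    sound′ (there y∈w) with sound y∈w
    ... | inj₁ (s<y , y<i) = inj₁ (<⇒≤ s<y , y<i)
    ... | inj₂ high        = inj₂ high
    complete′ : ∀ {y} → InRuns s t y → y ∈ s ∷ w
    complete′ {y} r with y ≟ s
    ... | yes refl = here refl
    complete′ (inj₁ (s≤y , y<i)) | no y≢s =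
      there (complete (inj₁ (≤∧≢⇒< s≤y (y≢s ∘ sym) , y<i)))
    complete′ (inj₂ high)        | no _   = there (complete (inj₂ high))
    ascending-low′ : ∀ y → s ≤ y → suc y < i → Precedes y (suc y) (s ∷ w)
    ascending-low′ y s≤y sy<i with y ≟ s
    ... | yes refl = now (complete (inj₁ (≤-refl , sy<i)))
    ... | no y≢s   = later (ascending-low y (≤∧≢⇒< s≤y (y≢s ∘ sym)) sy<i)

  IsShuffle-∷-high : ∀ {s t w} → t < n → i ≤ t → IsShuffle s (suc t) w → IsShuffle s t (t ∷ w)
  IsShuffle-∷-high {s} {t} {w} t<n i≤t S = record
    { unique = ¬Any⇒All¬ w t∉w ∷ unique ; sound = sound′ ; complete = complete′
    ; ascending-low  = λ y s≤y sy<i → later (ascending-low y s≤y sy<i)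
    ; ascending-high = ascending-high′ }
    where
    open IsShuffle S
    t∉w : t ∉ w
    t∉w t∈w with sound t∈w
    ... | inj₁ (_ , t<i) = <⇒≱ t<i i≤t
    ... | inj₂ (t<t , _) = <-irrefl refl t<t
    sound′ : ∀ {y} → y ∈ t ∷ w → InRuns s t y
    sound′ (here refl) = inj₂ (≤-refl , t<n)
    sound′ (there y∈w) with sound y∈w
    ... | inj₁ low         = inj₁ low
    ... | inj₂ (t<y , y<n) = inj₂ (<⇒≤ t<y , y<n)
    complete′ : ∀ {y} → InRuns s t y → y ∈ t ∷ w
    complete′ {y} r with y ≟ t
    ... | yes refl = here refl
    complete′ (inj₁ low)         | no _   = there (complete (inj₁ low))
    complete′ (inj₂ (t≤y , y<n)) | no y≢t =
      there (complete (inj₂ (≤∧≢⇒< t≤y (y≢t ∘ sym) , y<n)))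
    ascending-high′ : ∀ y → t ≤ y → suc y < n → Precedes y (suc y) (t ∷ w)
    ascending-high′ y t≤y sy<n with y ≟ t
    ... | yes refl = now (complete (inj₂ (≤-refl , sy<n)))
    ... | no y≢t   = later (ascending-high y (≤∧≢⇒< t≤y (y≢t ∘ sym)) sy<n)

  IsShuffle-tail-low : ∀ {s t w} → s < i → i ≤ t → IsShuffle s t (s ∷ w) → IsShuffle (suc s) t w
  IsShuffle-tail-low {s} {t} {w} s<i i≤t S = record
    { unique = unique-w ; sound = sound′ ; complete = complete′
    ; ascending-low  = λ y s<y sy<i →
        Precedes-tail (ascending-low y (<⇒≤ s<y) sy<i) (λ y≡s → <-irrefl (sym y≡s) s<y)
    ; ascending-high = λ y t≤y sy<n →
        Precedes-tail (ascending-high y t≤y sy<n) (λ { refl → <⇒≱ s<i (≤-trans i≤t t≤y) }) }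
    where
    open IsShuffle S
    s∉w : s ∉ w
    s∉w with unique
    ... | s≢w ∷ _ = All¬⇒¬Any s≢w
    unique-w : Unique w
    unique-w with unique
    ... | _ ∷ u = u
    sound′ : ∀ {y} → y ∈ w → InRuns (suc s) t y
    sound′ {y} y∈w with sound (there y∈w)
    ... | inj₁ (s≤y , y<i) = inj₁ (≤∧≢⇒< s≤y (λ { refl → s∉w y∈w }) , y<i)
    ... | inj₂ high        = inj₂ high
    complete′ : ∀ {y} → InRuns (suc s) t y → y ∈ w
    complete′ (inj₁ (s<y , y<i)) with complete (inj₁ (<⇒≤ s<y , y<i))
    ... | here refl  = ⊥-elim (<-irrefl refl s<y)
    ... | there y∈w  = y∈w
    complete′ (inj₂ (t≤y , y<n)) with complete (inj₂ (t≤y , y<n))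
    ... | here refl  = ⊥-elim (<⇒≱ s<i (≤-trans i≤t t≤y))
    ... | there y∈w  = y∈w

  IsShuffle-tail-high : ∀ {s t w} → i ≤ t → IsShuffle s t (t ∷ w) → IsShuffle s (suc t) w
  IsShuffle-tail-high {s} {t} {w} i≤t S = record
    { unique = unique-w ; sound = sound′ ; complete = complete′
    ; ascending-low  = λ y s≤y sy<i → Precedes-tail (ascending-low y s≤y sy<i)
                                        (λ y≡t → <-irrefl y≡t (<-≤-trans (<-trans (n<1+n y) sy<i) i≤t))
    ; ascending-high = λ y t<y sy<n →
        Precedes-tail (ascending-high y (<⇒≤ t<y) sy<n) (λ y≡t → <-irrefl (sym y≡t) t<y) }
    where
    open IsShuffle S
    t∉w : t ∉ w
    t∉w with unique
    ... | t≢w ∷ _ = All¬⇒¬Any t≢w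
    unique-w : Unique w
    unique-w with unique
    ... | _ ∷ u = u
    sound′ : ∀ {y} → y ∈ w → InRuns s (suc t) y
    sound′ {y} y∈w with sound (there y∈w)
    ... | inj₁ low         = inj₁ low
    ... | inj₂ (t≤y , y<n) = inj₂ (≤∧≢⇒< t≤y (λ { refl → t∉w y∈w }) , y<n)
    complete′ : ∀ {y} → InRuns s (suc t) y → y ∈ w
    complete′ (inj₁ (s≤y , y<i)) with complete (inj₁ (s≤y , y<i))
    ... | here refl  = ⊥-elim (<⇒≱ y<i i≤t)
    ... | there y∈w  = y∈w
    complete′ (inj₂ (t<y , y<n)) with complete (inj₂ (<⇒≤ t<y , y<n))
    ... | here refl  = ⊥-elim (<-irrefl refl t<y)
    ... | there y∈w  = y∈w

  IsShuffle-[] : IsShuffle i n []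
  IsShuffle-[] = record
    { unique = [] ; sound = λ ()
    ; complete = λ { (inj₁ (i≤y , y<i)) → ⊥-elim (<⇒≱ y<i i≤y)
                   ; (inj₂ (n≤y , y<n)) → ⊥-elim (<⇒≱ y<n n≤y) }
    ; ascending-low  = λ y i≤y sy<i → ⊥-elim (<⇒≱ (<-trans (n<1+n y) sy<i) i≤y)
    ; ascending-high = λ y n≤y sy<n → ⊥-elim (<⇒≱ (<-trans (n<1+n y) sy<n) n≤y) }

  shuffleIndicator≡1⇒IsShuffle : ∀ s t w → i ≤ t → shuffleIndicator s t w ≡ 1 → IsShuffle s t w
  shuffleIndicator≡1⇒IsShuffle s t [] i≤t ind≡1 with s ≟ i | t ≟ n
  ... | yes refl | yes refl = IsShuffle-[]
  shuffleIndicator≡1⇒IsShuffle s t [] i≤t () | yes _ | no _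
  shuffleIndicator≡1⇒IsShuffle s t [] i≤t () | no _  | _
  shuffleIndicator≡1⇒IsShuffle s t (x ∷ w) i≤t ind≡1 with x ≟ s | s <? i | x ≟ t | t <? n
  ... | yes refl | yes s<i | yes refl | _ = ⊥-elim (<⇒≱ s<i i≤t)
  ... | yes refl | yes s<i | no _ | _ =
    IsShuffle-∷-low s<i i≤t
      (shuffleIndicator≡1⇒IsShuffle (suc s) t w i≤t (trans (sym (+-identityʳ _)) ind≡1))
  ... | yes _ | no _ | yes refl | yes t<n =
    IsShuffle-∷-high t<n i≤t (shuffleIndicator≡1⇒IsShuffle s (suc t) w (m≤n⇒m≤1+n i≤t) ind≡1)
  ... | no _  | _    | yes refl | yes t<n =
    IsShuffle-∷-high t<n i≤t (shuffleIndicator≡1⇒IsShuffle s (suc t) w (m≤n⇒m≤1+n i≤t) ind≡1)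
  shuffleIndicator≡1⇒IsShuffle s t (x ∷ w) i≤t () | yes _ | no _ | yes _ | no _
  shuffleIndicator≡1⇒IsShuffle s t (x ∷ w) i≤t () | yes _ | no _ | no _  | _
  shuffleIndicator≡1⇒IsShuffle s t (x ∷ w) i≤t () | no _  | _    | yes _ | no _
  shuffleIndicator≡1⇒IsShuffle s t (x ∷ w) i≤t () | no _  | _    | no _  | _

  IsShuffle⇒shuffleIndicator≡1 : ∀ s t w → s ≤ i → i ≤ t → t ≤ n →
                                 IsShuffle s t w → shuffleIndicator s t w ≡ 1
  IsShuffle⇒shuffleIndicator≡1 s t [] s≤i i≤t t≤n S =
    trans (when-yes (s ≟ i) s≡i _) (when-yes (t ≟ n) t≡n 1)
    where
    open IsShuffle S
    s≡i : s ≡ i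
    s≡i with s <? i
    ... | yes s<i with () ← complete (inj₁ (≤-refl , s<i))
    ... | no s≮i = ≤-antisym s≤i (≮⇒≥ s≮i)
    t≡n : t ≡ n
    t≡n with t <? n
    ... | yes t<n with () ← complete (inj₂ (≤-refl , t<n))
    ... | no t≮n = ≤-antisym t≤n (≮⇒≥ t≮n)
  IsShuffle⇒shuffleIndicator≡1 s t (x ∷ w) s≤i i≤t t≤n S with IsShuffle.sound S (here refl)
  ... | inj₁ (s≤x , x<i)
    with refl ← head-is-least (IsShuffle.unique S) s≤x
                  (λ y s≤y sy≡x → IsShuffle.ascending-low S y s≤y (subst (_< i) (sym sy≡x) x<i)) =
    cong₂ _+_
      (trans (when-yes (x ≟ x) refl _) (trans (when-yes (x <? i) x<i _)
        (IsShuffle⇒shuffleIndicator≡1 (suc x) t w x<i i≤t t≤n (IsShuffle-tail-low x<i i≤t S))))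
      (when-no (x ≟ t) (λ x≡t → <-irrefl x≡t (<-≤-trans x<i i≤t)) _)
  ... | inj₂ (t≤x , x<n)
    with refl ← head-is-least (IsShuffle.unique S) t≤x
                  (λ y t≤y sy≡x → IsShuffle.ascending-high S y t≤y (subst (_< n) (sym sy≡x) x<n)) =
    cong₂ _+_ low-branch-vanishes
      (trans (when-yes (x ≟ x) refl _) (trans (when-yes (x <? n) x<n _)
        (IsShuffle⇒shuffleIndicator≡1 s (suc x) w s≤i (m≤n⇒m≤1+n i≤t) x<n
          (IsShuffle-tail-high i≤t S))))
    where
    low-branch-vanishes : when (x ≟ s) (when (s <? i) (shuffleIndicator (suc s) x w)) ≡ 0
    low-branch-vanishes with x ≟ s
    ... | yes refl = when-no (x <? i) (λ x<i → <⇒≱ x<i i≤t) _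
    ... | no _     = refl

  Des-inverse⇒Precedes : ∀ (v : Vec (Fin n) n) → Injective _≡_ _≡_ (lookup v) →
    All (_≡ i) (Des n (val (inv (lookup v)))) →
    ∀ y → suc y < n → suc y ≢ i → Precedes y (suc y) (word v)
  Des-inverse⇒Precedes v inj des y sy<n sy≢i =
    subst₂ (λ a b → Precedes a b (word v)) vp≡y vp′≡sy (positions⇒Precedes-word v p p′ p<p′)
    where
    r = lookup v
    p  = proj₁ (preimage-toℕ r inj y (<-trans (n<1+n y) sy<n))
    p′ = proj₁ (preimage-toℕ r inj (suc y) sy<n)
    vp≡y : toℕ (r p) ≡ y
    vp≡y = proj₂ (preimage-toℕ r inj y (<-trans (n<1+n y) sy<n))
    vp′≡sy : toℕ (r p′) ≡ suc y
    vp′≡sy = proj₂ (preimage-toℕ r inj (suc y) sy<n)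
    p′≮p : ¬ toℕ p′ < toℕ p
    p′≮p p′<p = sy≢i (All-Des⁻ n (val (inv r)) des y (suc<⇒<∸1 n sy<n)
                       (subst₂ _<_ (sym (val-inv r inj vp′≡sy)) (sym (val-inv r inj vp≡y)) (s≤s p′<p)))
    p≢p′ : toℕ p ≢ toℕ p′
    p≢p′ p≡p′ =
      <-irrefl (trans (sym vp≡y) (trans (cong (toℕ ∘ r) (toℕ-injective p≡p′)) vp′≡sy)) (n<1+n y)
    p<p′ : toℕ p < toℕ p′
    p<p′ = ≤∧≢⇒< (≮⇒≥ p′≮p) p≢p′

  perm⇒IsShuffle : ∀ (v : Vec (Fin n) n) → Injective _≡_ _≡_ (lookup v) →
                   All (_≡ i) (Des n (val (inv (lookup v)))) → IsShuffle 0 i (word v)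
  perm⇒IsShuffle v inj des = record
    { unique = Injective⇒Unique-word v inj ; sound = sound ; complete = complete
    ; ascending-low  = λ y _ sy<i →
        Des-inverse⇒Precedes v inj des y (<-≤-trans sy<i i≤n) (λ sy≡i → <-irrefl sy≡i sy<i)
    ; ascending-high = λ y i≤y sy<n →
        Des-inverse⇒Precedes v inj des y sy<n (λ sy≡i → <-irrefl (sym sy≡i) (s≤s i≤y)) }
    where
    sound : ∀ {y} → y ∈ word v → InRuns 0 i y
    sound {y} y∈v with y <? i
    ... | yes y<i = inj₁ (z≤n , y<i)
    ... | no y≮i with p , vp≡y ← ∈word⇒lookup v y∈v =
      inj₂ (≮⇒≥ y≮i , subst (_< n) vp≡y (toℕ<n (lookup v p)))
    bounded : ∀ {y} → InRuns 0 i y → y < n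
    bounded (inj₁ (_ , y<i)) = <-≤-trans y<i i≤n
    bounded (inj₂ (_ , y<n)) = y<n
    complete : ∀ {y} → InRuns 0 i y → y ∈ word v
    complete {y} r with p , vp≡y ← preimage-toℕ (lookup v) inj y (bounded r) =
      subst (_∈ word v) vp≡y (toℕ-lookup∈word v p)

  IsShuffle⇒perm : ∀ (v : Vec (Fin n) n) → IsShuffle 0 i (word v) →
                   Injective _≡_ _≡_ (lookup v) × All (_≡ i) (Des n (val (inv (lookup v))))
  IsShuffle⇒perm v S = inj , All-Des⁺ n (val (inv r)) descent-only-at-i
    where
    open IsShuffle S
    r = lookup v
    inj = Unique-word⇒Injective v unique
    ascending : ∀ y → suc y < n → suc y ≢ i → Precedes y (suc y) (word v)
    ascending y sy<n sy≢i with suc y <? i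
    ... | yes sy<i = ascending-low y z≤n sy<i
    ... | no sy≮i  = ascending-high y (s≤s⁻¹ (≤∧≢⇒< (≮⇒≥ sy≮i) (sy≢i ∘ sym))) sy<n
    descent-only-at-i : ∀ y → y < n ∸ 1 → val (inv r) (suc (suc y)) < val (inv r) (suc y) → suc y ≡ i
    descent-only-at-i y y<n∸1 descent with suc y ≟ i
    ... | yes sy≡i = sy≡i
    ... | no sy≢i
      with p , p′ , p<p′ , vp≡y , vp′≡sy
             ← Precedes-word⇒positions v (ascending y (<∸1⇒suc< n y<n∸1) sy≢i) =
      ⊥-elim (<-asym p<p′ (s≤s⁻¹ (subst₂ _<_ (val-inv r inj vp′≡sy) (val-inv r inj vp≡y) descent)))

  perm⇒shuffleIndicator≡1 : ∀ (v : Vec (Fin n) n) → Injective _≡_ _≡_ (lookup v) →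
    All (_≡ i) (Des n (val (inv (lookup v)))) → shuffleIndicator 0 i (word v) ≡ 1
  perm⇒shuffleIndicator≡1 v inj des =
    IsShuffle⇒shuffleIndicator≡1 0 i (word v) z≤n ≤-refl i≤n (perm⇒IsShuffle v inj des)

  ¬perm⇒shuffleIndicator≡0 : ∀ (v : Vec (Fin n) n) →
    ¬ (Injective _≡_ _≡_ (lookup v) × All (_≡ i) (Des n (val (inv (lookup v))))) →
    shuffleIndicator 0 i (word v) ≡ 0
  ¬perm⇒shuffleIndicator≡0 v ¬perm with n≤1⇒n≡0∨n≡1 (shuffleIndicator≤1 0 i (word v) ≤-refl)
  ... | inj₁ ind≡0 = ind≡0
  ... | inj₂ ind≡1 =
    ⊥-elim (¬perm (IsShuffle⇒perm v (shuffleIndicator≡1⇒IsShuffle 0 i (word v) ≤-refl ind≡1)))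

m+[1+n]≡o⇒m<o : ∀ m n {o} → m + suc n ≡ o → m < o
m+[1+n]≡o⇒m<o m n refl = m<m+n m (s≤s z≤n)

module ShuffleSums (n i : ℕ) (i≤n : i ≤ n) (q : ℕ) (σ : ℕ → ℕ)
  (σ-low<σ-high : ∀ x y → x < i → i ≤ y → σ x < σ y)
  (σ-high-ascending : ∀ y → i ≤ y → σ y < σ (suc y)) where

  open Shuffles n i i≤n
  open QBinomial q

  shuffleSum : ℕ → ℕ → ℕ → ℕ → ℕ
  shuffleSum k s t c = sum (map (λ w → q ^ rmajList (c ∷ map σ w)) (shuffles k s t))

  shuffleSum-zero : ∀ s t c → s ≡ i → t ≡ n → shuffleSum 0 s t c ≡ 1
  shuffleSum-zero s t c s≡i t≡n with s ≟ i | t ≟ n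
  ... | yes _   | yes _   = refl
  ... | no s≢i  | _       = ⊥-elim (s≢i s≡i)
  ... | yes _   | no t≢n  = ⊥-elim (t≢n t≡n)

  -- All words in shuffles k s t have length k, so the descent created by the prefix c weighs k + 1.
  shuffleSum-prefix : ∀ k s t x c →
    sum (map (λ w → q ^ rmajList (c ∷ map σ w)) (map (x ∷_) (shuffles k s t)))
    ≡ q ^ when (σ x <? c) (suc k) * shuffleSum k s t (σ x)
  shuffleSum-prefix k s t x c = begin
    sum (map (λ w → q ^ rmajList (c ∷ map σ w)) (map (x ∷_) W))
      ≡⟨ sum-map-∘ (λ w → q ^ rmajList (c ∷ map σ w)) (x ∷_) W ⟩
    sum (map (λ w → q ^ (when (σ x <? c) (suc (length (map σ w))) + rmajList (σ x ∷ map σ w))) W)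
      ≡⟨ cong sum (map-cong-local (All.map (λ {w} → length-is-k {w}) (length-shuffles k s t))) ⟩
    sum (map (λ w → q ^ (when (σ x <? c) (suc k) + rmajList (σ x ∷ map σ w))) W)
      ≡⟨ sum-map-cong (λ w → ^-distribˡ-+-* q (when (σ x <? c) (suc k)) (rmajList (σ x ∷ map σ w))) W ⟩
    sum (map (λ w → q ^ when (σ x <? c) (suc k) * q ^ rmajList (σ x ∷ map σ w)) W)
      ≡⟨ sum-map-*ˡ (q ^ when (σ x <? c) (suc k)) (λ w → q ^ rmajList (σ x ∷ map σ w)) W ⟩
    q ^ when (σ x <? c) (suc k) * shuffleSum k s t (σ x) ∎
    where
    open ≡-Reasoning
    W = shuffles k s t
    length-is-k : ∀ {w} → length w ≡ k →
      q ^ (when (σ x <? c) (suc (length (map σ w))) + rmajList (σ x ∷ map σ w))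
      ≡ q ^ (when (σ x <? c) (suc k) + rmajList (σ x ∷ map σ w))
    length-is-k {w} |w|≡k =
      cong (λ l → q ^ (when (σ x <? c) (suc l) + rmajList (σ x ∷ map σ w)))
           (trans (length-map σ w) |w|≡k)

  shuffleSum-suc : ∀ k s t c → shuffleSum (suc k) s t c
    ≡ when (s <? i) (q ^ when (σ s <? c) (suc k) * shuffleSum k (suc s) t (σ s))
      + when (t <? n) (q ^ when (σ t <? c) (suc k) * shuffleSum k s (suc t) (σ t))
  shuffleSum-suc k s t c = trans (sum-map-shuffles-suc (λ w → q ^ rmajList (c ∷ map σ w)) k s t)
    (cong₂ _+_ (cong (when (s <? i)) (trans (sym (sum-map-∘ _ (s ∷_) (shuffles k (suc s) t)))
                                            (shuffleSum-prefix k (suc s) t s c)))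
               (cong (when (t <? n)) (trans (sym (sum-map-∘ _ (t ∷_) (shuffles k s (suc t))))
                                            (shuffleSum-prefix k s (suc t) t c))))

  shuffleSum-low-suc : ∀ k s t → s < i → i ≤ t → shuffleSum (suc k) (suc s) t (σ s)
    ≡ when (suc s <? i) (q ^ when (σ (suc s) <? σ s) (suc k) * shuffleSum k (suc (suc s)) t (σ (suc s)))
      + when (t <? n) (shuffleSum k (suc s) (suc t) (σ t))
  shuffleSum-low-suc k s t s<i i≤t = trans (shuffleSum-suc k (suc s) t (σ s))
    (cong (continue-low +_)
          (cong (when (t <? n)) (trans (cong (λ e → q ^ e * high) no-descent) (+-identityʳ high))))
    where
    high = shuffleSum k (suc s) (suc t) (σ t)
    continue-low =
      when (suc s <? i) (q ^ when (σ (suc s) <? σ s) (suc k) * shuffleSum k (suc (suc s)) t (σ (suc s)))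
    no-descent : when (σ t <? σ s) (suc k) ≡ 0
    no-descent = when-no (σ t <? σ s) (<⇒≯ (σ-low<σ-high s t s<i i≤t)) (suc k)

  shuffleSum-high-suc : ∀ k s t → i ≤ t → shuffleSum (suc k) s (suc t) (σ t)
    ≡ when (s <? i) (q ^ suc k * shuffleSum k (suc s) (suc t) (σ s))
      + when (suc t <? n) (shuffleSum k s (suc (suc t)) (σ (suc t)))
  shuffleSum-high-suc k s t i≤t =
    trans (shuffleSum-suc k s (suc t) (σ t)) (cong₂ _+_ (low-descends (s <? i)) high-ascends)
    where
    low-descends : (d : Dec (s < i)) →
                   when d (q ^ when (σ s <? σ t) (suc k) * shuffleSum k (suc s) (suc t) (σ s))
                   ≡ when d (q ^ suc k * shuffleSum k (suc s) (suc t) (σ s))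
    low-descends (yes s<i) = cong (λ e → q ^ e * shuffleSum k (suc s) (suc t) (σ s))
                                  (when-yes (σ s <? σ t) (σ-low<σ-high s t s<i i≤t) (suc k))
    low-descends (no _)    = refl
    high-ascends :
      when (suc t <? n) (q ^ when (σ (suc t) <? σ t) (suc k) * shuffleSum k s (suc (suc t)) (σ (suc t)))
      ≡ when (suc t <? n) (shuffleSum k s (suc (suc t)) (σ (suc t)))
    high-ascends rewrite when-no (σ (suc t) <? σ t) (<-asym (σ-high-ascending t i≤t)) (suc k) =
      cong (when (suc t <? n)) (+-identityʳ _)

  private
    low-step : ∀ {p} {P : Set p} (d : Dec P) a b R →
      q ^ when d (suc (a + suc b)) * (q ^ R * gaussian (a + suc b) a)
        + q ^ R * (q ^ suc a * gaussian (a + suc b) (suc a))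
      ≡ q ^ (when d (suc a) + R) * gaussian (suc (a + suc b)) (suc a)
    low-step (no _) a b R = factor (q ^ R) (gaussian (a + suc b) a) (q ^ suc a) (gaussian (a + suc b) (suc a))
      where
      factor : ∀ r x p y → 1 * (r * x) + r * (p * y) ≡ r * (x + p * y)
      factor = solve-∀
    low-step (yes _) a b R
      rewrite gaussian-pascalʳ-+ a b | ^-distribˡ-+-* q (suc a) (suc b) | ^-distribˡ-+-* q (suc a) R =
      factor (q ^ suc a) (q ^ suc b) (q ^ R) (gaussian (a + suc b) a) (gaussian (a + suc b) (suc a))
      where
      factor : ∀ p₁ p₂ r x y → p₁ * p₂ * (r * x) + r * (p₁ * y) ≡ p₁ * r * (p₂ * x + y)
      factor = solve-∀

    high-step : ∀ a b R →
      q ^ suc (a + suc b) * (q ^ R * gaussian (a + suc b) a)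
        + q ^ R * (q ^ suc a * gaussian (a + suc b) (suc a))
      ≡ q ^ R * (q ^ suc a * gaussian (suc (a + suc b)) (suc a))
    high-step a b R rewrite gaussian-pascalʳ-+ a b | ^-distribˡ-+-* q (suc a) (suc b) =
      factor (q ^ suc a) (q ^ suc b) (q ^ R) (gaussian (a + suc b) a) (gaussian (a + suc b) (suc a))
      where
      factor : ∀ p₁ p₂ r x y → p₁ * p₂ * (r * x) + r * (p₁ * y) ≡ r * (p₁ * (p₂ * x + y))
      factor = solve-∀

    gaussian-+0-diag : ∀ a → gaussian (a + 0) a ≡ 1
    gaussian-+0-diag a rewrite +-identityʳ a = gaussian-diag a

    gaussian-suc-+0-diag : ∀ a → gaussian (suc (a + 0)) (suc a) ≡ 1
    gaussian-suc-+0-diag a rewrite +-identityʳ a = gaussian-diag (suc a)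

    rmaj-interval-suc : ∀ s a → rmajList (map σ (interval s (suc (suc a))))
                              ≡ when (σ (suc s) <? σ s) (suc a) + rmajList (map σ (interval (suc s) (suc a)))
    rmaj-interval-suc s a =
      cong (λ l → when (σ (suc s) <? σ s) (suc l) + rmajList (map σ (interval (suc s) (suc a))))
           (length-map-interval σ (suc (suc s)) a)

  -- Sums over the words that start with the low letter s, respectively the high letter t,
  -- followed by a further low and b further high letters.
  mutual
    shuffleSum-low : ∀ a b s t → suc s + a ≡ i → t + b ≡ n → i ≤ t →
      shuffleSum (a + b) (suc s) t (σ s) ≡ q ^ rmajList (map σ (interval s (suc a))) * gaussian (a + b) a
    shuffleSum-low zero zero s t s+1≡i t≡n _ =
      shuffleSum-zero (suc s) t (σ s) (trans (sym (+-identityʳ (suc s))) s+1≡i)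
                                      (trans (sym (+-identityʳ t)) t≡n)
    shuffleSum-low zero (suc b) s t s+1≡i t+b+1≡n i≤t =
      trans (shuffleSum-low-suc b s t (<-≤-trans (n<1+n s) (≤-reflexive s+1≡i′)) i≤t)
        (cong₂ _+_ (when-no (suc s <? i) (<-irrefl s+1≡i′) _)
                   (trans (when-yes (t <? n) (m+[1+n]≡o⇒m<o t b t+b+1≡n) _)
                          (shuffleSum-high zero b (suc s) t s+1≡i (trans (sym (+-suc t b)) t+b+1≡n) i≤t)))
      where
      s+1≡i′ : suc s ≡ i
      s+1≡i′ = trans (sym (+-identityʳ (suc s))) s+1≡i
    shuffleSum-low (suc a) zero s t s+a+2≡i t≡n i≤t =
      trans (shuffleSum-low-suc (a + 0) s t (<-trans (n<1+n s) s+1<i) i≤t) (begin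
        when (suc s <? i) (q ^ D (suc (a + 0)) * shuffleSum (a + 0) (suc (suc s)) t (σ (suc s)))
          + when (t <? n) (shuffleSum (a + 0) (suc s) (suc t) (σ t))
          ≡⟨ cong₂ _+_ (when-yes (suc s <? i) s+1<i _)
                       (when-no (t <? n) (<-irrefl (trans (sym (+-identityʳ t)) t≡n)) _) ⟩
        q ^ D (suc (a + 0)) * shuffleSum (a + 0) (suc (suc s)) t (σ (suc s)) + 0
          ≡⟨ cong (λ z → q ^ D (suc (a + 0)) * z + 0)
                  (shuffleSum-low a zero (suc s) t s+a+2≡i′ t≡n i≤t) ⟩
        q ^ D (suc (a + 0)) * (q ^ R * gaussian (a + 0) a) + 0
          ≡⟨ cong₂ (λ e g → q ^ D (suc e) * (q ^ R * g) + 0) (+-identityʳ a) (gaussian-+0-diag a) ⟩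
        q ^ D (suc a) * (q ^ R * 1) + 0
          ≡⟨ collect (q ^ D (suc a)) (q ^ R) ⟩
        q ^ D (suc a) * q ^ R * 1
          ≡⟨ cong₂ _*_ (sym (^-distribˡ-+-* q (D (suc a)) R)) (sym (gaussian-suc-+0-diag a)) ⟩
        q ^ (D (suc a) + R) * gaussian (suc (a + 0)) (suc a)
          ≡⟨ cong (λ e → q ^ e * gaussian (suc (a + 0)) (suc a)) (sym (rmaj-interval-suc s a)) ⟩
        q ^ rmajList (map σ (interval s (suc (suc a)))) * gaussian (suc a + 0) (suc a) ∎)
      where
      open ≡-Reasoning
      D = when (σ (suc s) <? σ s)
      R = rmajList (map σ (interval (suc s) (suc a)))
      s+a+2≡i′ : suc (suc s) + a ≡ i
      s+a+2≡i′ = trans (cong suc (sym (+-suc s a))) s+a+2≡i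
      s+1<i : suc s < i
      s+1<i = m+[1+n]≡o⇒m<o (suc s) a s+a+2≡i
      collect : ∀ x y → x * (y * 1) + 0 ≡ x * y * 1
      collect = solve-∀
    shuffleSum-low (suc a) (suc b) s t s+a+2≡i t+b+1≡n i≤t =
      trans (shuffleSum-low-suc (a + suc b) s t (<-trans (n<1+n s) s+1<i) i≤t)
        (trans (cong₂ _+_ (when-yes (suc s <? i) s+1<i _)
                          (when-yes (t <? n) (m+[1+n]≡o⇒m<o t b t+b+1≡n) _))
          (trans (cong₂ (λ u v → q ^ when (σ (suc s) <? σ s) (suc (a + suc b)) * u + v)
                        (shuffleSum-low a (suc b) (suc s) t s+a+2≡i′ t+b+1≡n i≤t)
                        starting-high)
            (trans (low-step (σ (suc s) <? σ s) a b R)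
              (cong (λ e → q ^ e * gaussian (suc (a + suc b)) (suc a)) (sym (rmaj-interval-suc s a))))))
      where
      R = rmajList (map σ (interval (suc s) (suc a)))
      s+a+2≡i′ : suc (suc s) + a ≡ i
      s+a+2≡i′ = trans (cong suc (sym (+-suc s a))) s+a+2≡i
      s+1<i : suc s < i
      s+1<i = m+[1+n]≡o⇒m<o (suc s) a s+a+2≡i
      starting-high : shuffleSum (a + suc b) (suc s) (suc t) (σ t)
                      ≡ q ^ R * (q ^ suc a * gaussian (a + suc b) (suc a))
      starting-high = begin
        shuffleSum (a + suc b) (suc s) (suc t) (σ t)
          ≡⟨ cong (λ k → shuffleSum k (suc s) (suc t) (σ t)) (+-suc a b) ⟩
        shuffleSum (suc a + b) (suc s) (suc t) (σ t)
          ≡⟨ shuffleSum-high (suc a) b (suc s) t s+a+2≡i (trans (sym (+-suc t b)) t+b+1≡n) i≤t ⟩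
        q ^ R * (q ^ suc a * gaussian (suc a + b) (suc a))
          ≡⟨ cong (λ k → q ^ R * (q ^ suc a * gaussian k (suc a))) (sym (+-suc a b)) ⟩
        q ^ R * (q ^ suc a * gaussian (a + suc b) (suc a)) ∎
        where open ≡-Reasoning

    shuffleSum-high : ∀ a b s t → s + a ≡ i → suc t + b ≡ n → i ≤ t →
      shuffleSum (a + b) s (suc t) (σ t) ≡ q ^ rmajList (map σ (interval s a)) * (q ^ a * gaussian (a + b) a)
    shuffleSum-high zero zero s t s≡i t+1≡n _ =
      shuffleSum-zero s (suc t) (σ t) (trans (sym (+-identityʳ s)) s≡i)
                                      (trans (sym (+-identityʳ (suc t))) t+1≡n)
    shuffleSum-high zero (suc b) s t s≡i t+b+2≡n i≤t =
      trans (shuffleSum-high-suc b s t i≤t)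
        (cong₂ _+_ (when-no (s <? i) (<-irrefl (trans (sym (+-identityʳ s)) s≡i)) _)
                   (trans (when-yes (suc t <? n) (m+[1+n]≡o⇒m<o (suc t) b t+b+2≡n) _)
                          (shuffleSum-high zero b s (suc t) s≡i (trans (sym (+-suc (suc t) b)) t+b+2≡n)
                                           (m≤n⇒m≤1+n i≤t))))
    shuffleSum-high (suc a) zero s t s+a+1≡i t+1≡n i≤t =
      trans (shuffleSum-high-suc (a + 0) s t i≤t) (begin
        when (s <? i) (q ^ suc (a + 0) * shuffleSum (a + 0) (suc s) (suc t) (σ s))
          + when (suc t <? n) (shuffleSum (a + 0) s (suc (suc t)) (σ (suc t)))
          ≡⟨ cong₂ _+_ (when-yes (s <? i) (m+[1+n]≡o⇒m<o s a s+a+1≡i) _)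
                       (when-no (suc t <? n) (<-irrefl (trans (sym (+-identityʳ (suc t))) t+1≡n)) _) ⟩
        q ^ suc (a + 0) * shuffleSum (a + 0) (suc s) (suc t) (σ s) + 0
          ≡⟨ cong (λ z → q ^ suc (a + 0) * z + 0)
                  (shuffleSum-low a zero s (suc t) (trans (sym (+-suc s a)) s+a+1≡i) t+1≡n
                                  (m≤n⇒m≤1+n i≤t)) ⟩
        q ^ suc (a + 0) * (q ^ R * gaussian (a + 0) a) + 0
          ≡⟨ cong₂ (λ e g → q ^ suc e * (q ^ R * g) + 0) (+-identityʳ a) (gaussian-+0-diag a) ⟩
        q ^ suc a * (q ^ R * 1) + 0
          ≡⟨ swap (q ^ suc a) (q ^ R) ⟩
        q ^ R * (q ^ suc a * 1)
          ≡⟨ cong (λ g → q ^ R * (q ^ suc a * g)) (sym (gaussian-suc-+0-diag a)) ⟩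
        q ^ R * (q ^ suc a * gaussian (suc a + 0) (suc a)) ∎)
      where
      open ≡-Reasoning
      R = rmajList (map σ (interval s (suc a)))
      swap : ∀ x y → x * (y * 1) + 0 ≡ y * (x * 1)
      swap = solve-∀
    shuffleSum-high (suc a) (suc b) s t s+a+1≡i t+b+2≡n i≤t =
      trans (shuffleSum-high-suc (a + suc b) s t i≤t)
        (trans (cong₂ _+_ (when-yes (s <? i) (m+[1+n]≡o⇒m<o s a s+a+1≡i) _)
                          (when-yes (suc t <? n) (m+[1+n]≡o⇒m<o (suc t) b t+b+2≡n) _))
          (trans (cong₂ (λ u v → q ^ suc (a + suc b) * u + v)
                   (shuffleSum-low a (suc b) s (suc t) (trans (sym (+-suc s a)) s+a+1≡i) t+b+2≡n
                                   (m≤n⇒m≤1+n i≤t))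
                   continuing-high)
            (high-step a b R)))
      where
      R = rmajList (map σ (interval s (suc a)))
      continuing-high : shuffleSum (a + suc b) s (suc (suc t)) (σ (suc t))
                        ≡ q ^ R * (q ^ suc a * gaussian (a + suc b) (suc a))
      continuing-high = begin
        shuffleSum (a + suc b) s (suc (suc t)) (σ (suc t))
          ≡⟨ cong (λ k → shuffleSum k s (suc (suc t)) (σ (suc t))) (+-suc a b) ⟩
        shuffleSum (suc a + b) s (suc (suc t)) (σ (suc t))
          ≡⟨ shuffleSum-high (suc a) b s (suc t) s+a+1≡i (trans (sym (+-suc (suc t) b)) t+b+2≡n)
                             (m≤n⇒m≤1+n i≤t) ⟩
        q ^ R * (q ^ suc a * gaussian (suc a + b) (suc a))
          ≡⟨ cong (λ k → q ^ R * (q ^ suc a * gaussian k (suc a))) (sym (+-suc a b)) ⟩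
        q ^ R * (q ^ suc a * gaussian (a + suc b) (suc a)) ∎
        where open ≡-Reasoning

module Relabelling (m a : ℕ) (a<m : a < m)
  (π : Fin (suc m) → Fin (suc m)) (π-injective : Injective _≡_ _≡_ π)
  (π-fixes-high : ∀ k → suc a ≤ toℕ k → π k ≡ k) (q : ℕ) where

  n i : ℕ
  n = suc m
  i = suc a

  i<n : i < n
  i<n = s≤s a<m

  -- σ x is the paper's π(x+1); beyond n it continues as the identity.
  σ : ℕ → ℕ
  σ x with x <? n
  ... | yes x<n = suc (toℕ (π (fromℕ< x<n)))
  ... | no _    = suc x

  σ≡val : ∀ x → x < n → σ x ≡ val π (suc x)
  σ≡val x x<n with x <? n
  ... | yes _   = refl
  ... | no x≮n  = ⊥-elim (x≮n x<n)

  σ-toℕ : ∀ y → σ (toℕ y) ≡ suc (toℕ (π y))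
  σ-toℕ y = trans (σ≡val (toℕ y) (toℕ<n y)) (val-suc-toℕ π y)

  σ-high : ∀ y → i ≤ y → σ y ≡ suc y
  σ-high y i≤y with y <? n
  ... | yes y<n = cong suc (trans (cong toℕ (π-fixes-high (fromℕ< y<n) i≤y′)) (toℕ-fromℕ< y<n))
    where
    i≤y′ : i ≤ toℕ (fromℕ< y<n)
    i≤y′ = subst (i ≤_) (sym (toℕ-fromℕ< y<n)) i≤y
  ... | no _    = refl

  π-low : ∀ x → toℕ x < i → toℕ (π x) < i
  π-low x x<i with toℕ (π x) <? i
  ... | yes πx<i = πx<i
  ... | no πx≮i  = ⊥-elim (<⇒≱ x<i (subst (λ z → i ≤ toℕ z) πx≡x (≮⇒≥ πx≮i)))
    where
    πx≡x : π x ≡ x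
    πx≡x = π-injective (π-fixes-high (π x) (≮⇒≥ πx≮i))

  σ-low<σ-high : ∀ x y → x < i → i ≤ y → σ x < σ y
  σ-low<σ-high x y x<i i≤y = subst₂ _<_ (sym σx≡πx) (sym (σ-high y i≤y))
    (s≤s (<-≤-trans (π-low (fromℕ< x<n) (subst (_< i) (sym (toℕ-fromℕ< x<n)) x<i)) i≤y))
    where
    x<n = <-trans x<i i<n
    σx≡πx : σ x ≡ suc (toℕ (π (fromℕ< x<n)))
    σx≡πx = trans (σ≡val x x<n) (val-suc π x x<n)

  σ-high-ascending : ∀ y → i ≤ y → σ y < σ (suc y)
  σ-high-ascending y i≤y =
    subst₂ _<_ (sym (σ-high y i≤y)) (sym (σ-high (suc y) (m≤n⇒m≤1+n i≤y))) (n<1+n (suc y))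

  open Shuffles n i (<⇒≤ i<n)
  open ShuffleSums n i (<⇒≤ i<n) q σ σ-low<σ-high σ-high-ascending
  open QBinomial q

  rmaj≡rmajList-word : ∀ (v : Vec (Fin n) n) → rmaj n (val (π ∘ lookup v)) ≡ rmajList (map σ (word v))
  rmaj≡rmajList-word v = trans (rmaj≡rmajList n (val (π ∘ lookup v)))
    (cong rmajList (applyUpTo≡map-word v (val (π ∘ lookup v) ∘ suc) σ
      (λ p → trans (val-suc-toℕ (π ∘ lookup v) p) (sym (σ-toℕ (lookup v p))))))

  rmaj-π : rmaj i (val π) ≡ rmajList (map σ (interval 0 i))
  rmaj-π = trans (rmaj≡rmajList i (val π))
    (cong rmajList (applyUpTo≡map-interval (val π ∘ suc) σ 0 i
                                           (λ k k<i → sym (σ≡val k (<-trans k<i i<n)))))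

  σ-head : List ℕ → ℕ
  σ-head []      = 0
  σ-head (x ∷ _) = σ x

  first-letter≡σ-head : ∀ (v : Vec (Fin n) n) → val (π ∘ lookup v) 1 ≡ σ-head (word v)
  first-letter≡σ-head (x ∷ᵥ v) =
    trans (val-suc-toℕ (π ∘ lookup (x ∷ᵥ v)) fzero) (sym (σ-toℕ x))

  isInjective? : (r : Fin n → Fin n) → Dec (∀ x y → r x ≡ r y → x ≡ y)
  isInjective? r = allᶠ? λ x → allᶠ? λ y → (r x ≟ᶠ r y) →-dec (x ≟ᶠ y)

  condition? : ∀ c (r : Fin n → Fin n) →
               Dec (All (_≡ i) (Des n (val (inv r))) × (val (π ∘ r) 1 ≡ c))
  condition? c r = all? (_≟ i) (Des n (val (inv r))) ×-dec (val (π ∘ r) 1 ≟ c)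

  weight : ℕ → List ℕ → ℕ
  weight c w = when (σ-head w ≟ c) (q ^ rmajList (map σ w))

  summand≡indicator*weight : ∀ c (v : Vec (Fin n) n) →
    when (isInjective? (lookup v)) (when (condition? c (lookup v)) (q ^ rmaj n (val (π ∘ lookup v))))
    ≡ shuffleIndicator 0 i (word v) * weight c (word v)
  summand≡indicator*weight c v with isInjective? (lookup v) | condition? c (lookup v)
  ... | no ¬inj | _ rewrite ¬perm⇒shuffleIndicator≡0 v (λ (inj , _) → ¬inj (λ x y → inj)) = refl
  ... | yes inj | yes (des , first≡c)
    rewrite perm⇒shuffleIndicator≡1 v (λ {x} {y} → inj x y) des
          | when-yes (σ-head (word v) ≟ c) (trans (sym (first-letter≡σ-head v)) first≡c)
                     (q ^ rmajList (map σ (word v)))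
          | rmaj≡rmajList-word v = sym (+-identityʳ _)
  ... | yes inj | no ¬cond with all? (_≟ i) (Des n (val (inv (lookup v))))
  ...   | yes des
    rewrite when-no (σ-head (word v) ≟ c)
                    (λ head≡c → ¬cond (des , trans (first-letter≡σ-head v) head≡c))
                    (q ^ rmajList (map σ (word v))) = sym (*-zeroʳ (shuffleIndicator 0 i (word v)))
  ...   | no ¬des rewrite ¬perm⇒shuffleIndicator≡0 v (¬des ∘ proj₂) = refl

  sum-perms≡sum-shuffles : ∀ c →
    sum (map (λ r → q ^ rmaj n (val (π ∘ r))) (filter (condition? c) (perms n)))
    ≡ sum (map (weight c) (shuffles n 0 i))
  sum-perms≡sum-shuffles c = begin
    sum (map Wt (filter (condition? c) (filter isInjective? (map lookup (allVecs n n)))))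
      ≡⟨ sum-map-filter (condition? c) Wt (filter isInjective? (map lookup (allVecs n n))) ⟩
    sum (map (λ r → when (condition? c r) (Wt r)) (filter isInjective? (map lookup (allVecs n n))))
      ≡⟨ sum-map-filter isInjective? (λ r → when (condition? c r) (Wt r)) (map lookup (allVecs n n)) ⟩
    sum (map (λ r → when (isInjective? r) (when (condition? c r) (Wt r))) (map lookup (allVecs n n)))
      ≡⟨ sum-map-∘ (λ r → when (isInjective? r) (when (condition? c r) (Wt r))) lookup (allVecs n n) ⟩
    sum (map (λ v → when (isInjective? (lookup v)) (when (condition? c (lookup v)) (Wt (lookup v))))
             (allVecs n n))
      ≡⟨ sum-map-cong (summand≡indicator*weight c) (allVecs n n) ⟩
    sum (map (λ v → shuffleIndicator 0 i (word v) * weight c (word v)) (allVecs n n))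
      ≡⟨ sum-allVecs-shuffleIndicator n 0 i (weight c) ⟩
    sum (map (weight c) (shuffles n 0 i)) ∎
    where
    open ≡-Reasoning
    Wt : (Fin n → Fin n) → ℕ
    Wt r = q ^ rmaj n (val (π ∘ r))

  sum-weight-shuffles : ∀ c → sum (map (weight c) (shuffles n 0 i))
    ≡ when (σ 0 ≟ c) (shuffleSum m 1 i (σ 0)) + when (σ i ≟ c) (shuffleSum m 0 (suc i) (σ i))
  sum-weight-shuffles c = trans (sum-map-shuffles-suc (weight c) m 0 i)
    (cong₂ _+_ (trans (when-yes (0 <? i) (s≤s z≤n) _) (sum-map-when (σ 0 ≟ c) _ (shuffles m 1 i)))
               (trans (when-yes (i <? n) i<n _) (sum-map-when (σ i ≟ c) _ (shuffles m 0 (suc i)))))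

  σ0<σi : σ 0 < σ i
  σ0<σi = σ-low<σ-high 0 i (s≤s z≤n) ≤-refl

  a≤m : a ≤ m
  a≤m = <⇒≤ a<m

  shuffleSum-starting-low : shuffleSum m 1 i (σ 0) ≡ q ^ rmajList (map σ (interval 0 i)) * gaussian m a
  shuffleSum-starting-low =
    subst (λ k → shuffleSum k 1 i (σ 0) ≡ q ^ rmajList (map σ (interval 0 i)) * gaussian k a)
          (m+[n∸m]≡n a≤m)
          (shuffleSum-low a (m ∸ a) 0 i refl (cong suc (m+[n∸m]≡n a≤m)) ≤-refl)

  shuffleSum-starting-high :
    shuffleSum m 0 (suc i) (σ i) ≡ q ^ rmajList (map σ (interval 0 i)) * (q ^ i * gaussian m i)
  shuffleSum-starting-high =
    subst (λ k → shuffleSum k 0 (suc i) (σ i) ≡ q ^ rmajList (map σ (interval 0 i)) * (q ^ i * gaussian k i))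
          (m+[n∸m]≡n a<m)
          (shuffleSum-high i (m ∸ i) 0 i refl (cong suc (m+[n∸m]≡n a<m)) ≤-refl)

  sum-first-letter-i+1 :
    sum (map (λ r → q ^ rmaj n (val (π ∘ r))) (filter (condition? (suc i)) (perms n)))
    ≡ q ^ rmaj i (val π) * (q ^ i * qbinom q m i)
  sum-first-letter-i+1 = begin
    sum (map (λ r → q ^ rmaj n (val (π ∘ r))) (filter (condition? (suc i)) (perms n)))
      ≡⟨ sum-perms≡sum-shuffles (suc i) ⟩
    sum (map (weight (suc i)) (shuffles n 0 i))
      ≡⟨ sum-weight-shuffles (suc i) ⟩
    when (σ 0 ≟ suc i) (shuffleSum m 1 i (σ 0)) + when (σ i ≟ suc i) (shuffleSum m 0 (suc i) (σ i))
      ≡⟨ cong₂ _+_ (when-no (σ 0 ≟ suc i) (λ σ0≡i+1 → <-irrefl (trans σ0≡i+1 (sym σi≡i+1)) σ0<σi) _)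
                   (when-yes (σ i ≟ suc i) σi≡i+1 _) ⟩
    shuffleSum m 0 (suc i) (σ i)
      ≡⟨ shuffleSum-starting-high ⟩
    q ^ rmajList (map σ (interval 0 i)) * (q ^ i * gaussian m i)
      ≡⟨ cong₂ (λ r g → q ^ r * (q ^ i * g)) (sym rmaj-π) (sym (qbinom≡gaussian m i a<m)) ⟩
    q ^ rmaj i (val π) * (q ^ i * qbinom q m i) ∎
    where
    open ≡-Reasoning
    σi≡i+1 : σ i ≡ suc i
    σi≡i+1 = σ-high i ≤-refl

  sum-first-letter-π₁ :
    sum (map (λ r → q ^ rmaj n (val (π ∘ r))) (filter (condition? (val π 1)) (perms n)))
    ≡ q ^ rmaj i (val π) * qbinom q m a
  sum-first-letter-π₁ = begin
    sum (map (λ r → q ^ rmaj n (val (π ∘ r))) (filter (condition? (val π 1)) (perms n)))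
      ≡⟨ sum-perms≡sum-shuffles (val π 1) ⟩
    sum (map (weight (val π 1)) (shuffles n 0 i))
      ≡⟨ sum-weight-shuffles (val π 1) ⟩
    when (σ 0 ≟ val π 1) (shuffleSum m 1 i (σ 0)) + when (σ i ≟ val π 1) (shuffleSum m 0 (suc i) (σ i))
      ≡⟨ cong₂ _+_ (when-yes (σ 0 ≟ val π 1) σ0≡π₁ _)
                   (when-no (σ i ≟ val π 1) (λ σi≡π₁ → <-irrefl (trans σ0≡π₁ (sym σi≡π₁)) σ0<σi) _) ⟩
    shuffleSum m 1 i (σ 0) + 0
      ≡⟨ +-identityʳ _ ⟩
    shuffleSum m 1 i (σ 0)
      ≡⟨ shuffleSum-starting-low ⟩
    q ^ rmajList (map σ (interval 0 i)) * gaussian m a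
      ≡⟨ cong₂ (λ r g → q ^ r * g) (sym rmaj-π) (sym (qbinom≡gaussian m a a≤m)) ⟩
    q ^ rmaj i (val π) * qbinom q m a ∎
    where
    open ≡-Reasoning
    σ0≡π₁ : σ 0 ≡ val π 1
    σ0≡π₁ = σ≡val 0 (s≤s z≤n)

lemma8p5 : (n i : ℕ) → 1 ≤ i → i < n →
  (π : Fin n → Fin n) → Injective _≡_ _≡_ π →
  (∀ k → i ≤ toℕ k → π k ≡ k) →
  (q : ℕ) →
  (sum (map (λ r → q ^ rmaj n (val (π ∘ r)))
      (filter (λ r → all? (_≟ i) (Des n (val (inv r))) ×-dec (val (π ∘ r) 1 ≟ suc i))
        (perms n)))
    ≡ q ^ rmaj i (val π) * (q ^ i * qbinom q (n ∸ 1) i))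
  ×
  (sum (map (λ r → q ^ rmaj n (val (π ∘ r)))
      (filter (λ r → all? (_≟ i) (Des n (val (inv r))) ×-dec (val (π ∘ r) 1 ≟ val π 1))
        (perms n)))
    ≡ q ^ rmaj i (val π) * qbinom q (n ∸ 1) (i ∸ 1))
lemma8p5 (suc m) (suc a) _ (s≤s a<m) π π-injective π-fixes-high q =
  sum-first-letter-i+1 , sum-first-letter-π₁
  where open Relabelling m a a<m π π-injective π-fixes-high q
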